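{- (1) If $q$ is even, then $\mathrm{Pr}(\mathrm{Fig}(T))$ is the set of all points of $m_T$. (2) If $q$ is odd, then $\mathrm{Pr}(\mathrm{Fig}(T))=\{T^\phi,T^{\phi^2}\}\cup\mathcal S_{ -1}\cup\bigcup\{\mathcal S_\theta:\theta\in\mathbb{F}_{q^3}^*,\ N(\theta)\text{ a nonzero square in }\mathbb{F}_q\}$. Further, $|\mathrm{Pr}(\mathrm{Fig}(T))|$ equals $2+\frac{q-1}{2}(q^2+q+1)$ if $q\equiv1\pmod 4$ and $2+\frac{q+1}{2}(q^2+q+1)$ if $q\equiv3\pmod4$.
   Context: Let $q$ be a prime power, $\mathbb{F}_{q^3}^*=\mathbb{F}_{q^3}\setminus\{0\}$, $N(x)=x^{q^2+q+1}$. Points of $\mathrm{PG}(2,q^3)$ have coordinates $(x,y,z)$, lines $[a,b,c]$, incidence iff $ax+by+cz=0$. Let $\phi$ be the collineation $(x,y,z)\mapsto(z^q,x^q,y^q)$ (on lines $[d,e,f]\mapsto[f^q,d^q,e^q]$). A point has Type I, II, III according as its $\phi$-orbit is one point, three collinear points, three non-collinear points; a line has Type I, II, III according as its $\phi$-orbit is one line, three concurrent lines, three non-concurrent lines. For a Type III line $\ell$ let $\mu(\ell)=\ell^\phi\cap\ell^{\phi^2}$. Let $T=(0,0,1)$, $T^\phi=(1,0,0)$, $T^{\phi^2}=(0,1,0)$, $m_T=[0,0,1]=T^\phi T^{\phi^2}$. The Fig-block $\mathrm{Fig}(T)$ is the point set $\mathcal E_T\cup\mathcal F_T$, where $\mathcal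 E_T$ is the set of Type II points on $m_T$ and $\mathcal F_T=\{\mu(\ell):\ell\text{ a Type III line through }T\}$ (note $T\notin\mathrm{Fig}(T)$). For $\theta\in\mathbb{F}_{q^3}^*$, $\mathcal S_\theta=\{(x\theta,x^q,0):x\in\mathbb{F}_{q^3}^*\}$. For a point set $\mathcal B$ not containing $T$, $\mathrm{Pr}(\mathcal B)=\{TP\cap m_T:P\in\mathcal B\}$. -}

module Defs where

open import Level using (0ℓ)
open import Data.Nat using (ℕ; zero; suc; _^_)
open import Data.Fin using (Fin)
open import Data.Product using (Σ; ∃; _×_; _,_)
open import Data.Sum using (_⊎_)
open import Relation.Nullary using (¬_)
open import Relation.Binary.PropositionalEquality using (_≡_; _≢_)
open import Function.Bundles using (_↔_)
open import Algebra.Structures using (IsCommutativeRing)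
open import Data.Nat.Primality using (Prime)

IsPrimePower : ℕ → Set
IsPrimePower q = Σ ℕ λ p → Σ ℕ λ k → Prime p × q ≡ p ^ suc k

record FiniteField (n : ℕ) : Set₁ where
  infixl 7 _*_
  infixl 6 _+_
  field
    Carrier    : Set
    _+_ _*_    : Carrier → Carrier → Carrier
    -_         : Carrier → Carrier
    0# 1#      : Carrier
    isCommRing : IsCommutativeRing _≡_ _+_ _*_ -_ 0# 1#
    0≢1        : 0# ≢ 1#
    inverse    : ∀ x → x ≢ 0# → Σ Carrier λ y → x * y ≡ 1#
    enum       : Carrier ↔ Fin n

module Plane (q : ℕ) (F : FiniteField (q ^ 3)) where
  open FiniteField F

  pow : Carrier → ℕ → Carrier
  pow x zero    = 1#
  pow x (suc n) = x * pow x n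

  fr : Carrier → Carrier
  fr x = pow x q

  N : Carrier → Carrier
  N x = pow x (q ^ 2 Data.Nat.+ q Data.Nat.+ 1)

  InFq : Carrier → Set
  InFq x = fr x ≡ x

  -- coordinate triples (used both for points (x,y,z) and lines [a,b,c])
  Triple : Set
  Triple = Carrier × Carrier × Carrier

  zero3 : Triple
  zero3 = 0# , 0# , 0#

  -- a triple represents a point / line of PG(2,q^3) iff it is nonzero
  Proper : Triple → Set
  Proper v = v ≢ zero3

  scale : Carrier → Triple → Triple
  scale c (x , y , z) = (c * x , c * y , c * z)

  _∼_ : Triple → Triple → Set
  u ∼ v = Proper u × Proper v × Σ Carrier λ c → c ≢ 0# × v ≡ scale c u

  Inc : Triple → Triple → Set
  Inc (x , y , z) (a , b , c) = a * x + b * y + c * z ≡ 0#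

  -- the collineation φ on points (x,y,z) ↦ (z^q,x^q,y^q);
  -- on lines [d,e,f] ↦ [f^q,d^q,e^q] (same formula)
  φ : Triple → Triple
  φ (x , y , z) = (fr z , fr x , fr y)

  φ² : Triple → Triple
  φ² v = φ (φ v)

  Collinear : Triple → Triple → Triple → Set
  Collinear P Q R = Σ Triple λ ℓ → Proper ℓ × Inc P ℓ × Inc Q ℓ × Inc R ℓ

  Concurrent : Triple → Triple → Triple → Set
  Concurrent l m n = Σ Triple λ P → Proper P × Inc P l × Inc P m × Inc P n

  PointTypeI : Triple → Set
  PointTypeI P = Proper P × (φ P ∼ P)

  PointTypeII : Triple → Set
  PointTypeII P = Proper P × ¬ (φ P ∼ P) × Collinear P (φ P) (φ² P)

  PointTypeIII : Triple → Set
  PointTypeIII P = Proper P × ¬ Collinear P (φ P) (φ² P)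

  LineTypeI : Triple → Set
  LineTypeI ℓ = Proper ℓ × (φ ℓ ∼ ℓ)

  LineTypeII : Triple → Set
  LineTypeII ℓ = Proper ℓ × ¬ (φ ℓ ∼ ℓ) × Concurrent ℓ (φ ℓ) (φ² ℓ)

  LineTypeIII : Triple → Set
  LineTypeIII ℓ = Proper ℓ × ¬ Concurrent ℓ (φ ℓ) (φ² ℓ)

  -- point sets are predicates on triples (all sets below are closed under ∼)
  PointSet : Set₁
  PointSet = Triple → Set

  T : Triple
  T = (0# , 0# , 1#)

  m_T : Triple
  m_T = (0# , 0# , 1#)   -- the line [0,0,1] = T^φ T^{φ²}

  -- P is (a representative of) μ(ℓ) = ℓ^φ ∩ ℓ^{φ²}
  IsMu : Triple → Triple → Set
  IsMu ℓ P = Proper P × Inc P (φ ℓ) × Inc P (φ² ℓ)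

  ℰ_T : PointSet
  ℰ_T P = PointTypeII P × Inc P m_T

  ℱ_T : PointSet
  ℱ_T P = Σ Triple λ ℓ → LineTypeIII ℓ × Inc T ℓ × IsMu ℓ P

  Fig_T : PointSet
  Fig_T P = ℰ_T P ⊎ ℱ_T P

  -- Pr(B) = { TP ∩ m_T : P ∈ B }  (Q is TP ∩ m_T: Q on m_T and on the line TP)
  Pr : PointSet → PointSet
  Pr B Q = Σ Triple λ P → B P × ¬ (P ∼ T) × Proper Q × Inc Q m_T
           × Σ Triple λ ℓ → Proper ℓ × Inc T ℓ × Inc P ℓ × Inc Q ℓ

  𝒮 : Carrier → PointSet
  𝒮 θ Q = Σ Carrier λ x → x ≢ 0# × (Q ∼ (x * θ , fr x , 0#))

  PointsOf-m_T : PointSet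
  PointsOf-m_T Q = Proper Q × Inc Q m_T

  _≐_ : PointSet → PointSet → Set
  A ≐ B = ∀ Q → Proper Q → (A Q → B Q) × (B Q → A Q)

  HasSize : PointSet → ℕ → Set
  HasSize B n = Σ (Fin n → Triple) λ f →
      (∀ i → B (f i))
    × (∀ i j → f i ∼ f j → i ≡ j)
    × (∀ Q → B Q → Σ (Fin n) λ i → Q ∼ f i)

  RHS2 : PointSet
  RHS2 Q = (Q ∼ φ T) ⊎ (Q ∼ φ² T) ⊎ 𝒮 (- 1#) Q
         ⊎ Σ Carrier λ θ → θ ≢ 0# × (Σ Carrier λ s → InFq s × s ≢ 0# × s * s ≡ N θ) × 𝒮 θ Q

-- Points of m_T are e1 = T^φ = (1,0,0) and pt y = (y,1,0), and projecting from T forgets the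
-- last coordinate.  The φ-orbit of a point or line (a,b,0) has determinant N a + N b.  Hence a
-- Type II point of m_T is a multiple of pt y with N y = −1, while for a Type III line
-- ℓ = [a,b,0] through T the point μ(ℓ) projects to (cofactor a, cofactor b, 0), where
-- cofactor x = x^q x^{q²}.  As N (cofactor x) = (N x)², this is e1, pt 0, or pt y with N y the
-- square of N(a/b) ∈ F_q^*.  Conversely, if N y = t² with t ∈ F_q^*, t ≠ −1, then
-- ℓ = [t/y, 1, 0] has N(t/y) = t, so it is of Type III and μ(ℓ) projects to pt y.  Thus
-- Pr(Fig(T)) = {e1} ∪ {pt y : y = 0, N y = −1 or N y ∈ (F_q^*)²}; by Hilbert 90
-- (N y = −1 iff pt y ∈ 𝒮_{−1}) this is the set in (2), and for even q every N y is the square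
-- of N(y)^{q/2}.  For the count, x ↦ x^e maps F^* onto the f-th roots of unity whenever
-- e f = q³ − 1, because a polynomial of degree e has at most e roots.  With q = 2r + 1 and
-- K = q² + q + 1 there are r K elements y whose norm is a nonzero square (y^{rK} = 1) and K of
-- norm −1; the latter lie among the former iff (−1)^r = 1, i.e. iff q ≡ 1 (mod 4).

module Submission where

open import Level using (0ℓ)
open import Algebra.Bundles using (CommutativeRing)
import Algebra.Properties.CommutativeSemiring.Exp as CommutativeSemiringExp
import Algebra.Properties.Monoid.Mult.TCOptimised as MonoidMult
import Algebra.Properties.Ring as RingProperties
import Algebra.Properties.Semiring.Exp as SemiringExp
import Algebra.Properties.Semiring.Mult.TCOptimised as SemiringMult
import Algebra.Solver.Ring
import Algebra.Solver.Ring.AlmostCommutativeRing as ACR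
open import Data.Empty using (⊥; ⊥-elim)
import Data.Fin as Fin
open import Data.Fin.Properties using (inj⇒≟)
open import Data.Integer as ℤ using (ℤ; -[1+_])
import Data.Integer.Properties as ℤ
open import Data.List using (List; []; _∷_; _++_; length; map; filter; tabulate; foldr; replicate; lookup)
open import Data.List.Membership.Propositional using (_∈_; find)
open import Data.List.Membership.Propositional.Properties
  using (∈-tabulate⁺; ∈-filter⁺; ∈-filter⁻; ∈-map⁺; ∈-map⁻; ∈-length; ∈-lookup; ∈-++⁺ˡ; ∈-++⁺ʳ; ∈-++⁻)
open import Data.List.Membership.Propositional.Properties.WithK using (unique∧set⇒bag)
open import Data.List.Properties using (length-tabulate; length-map; length-replicate; length-++; filter-notAll)
open import Data.List.Relation.Binary.BagAndSetEquality using (∼bag⇒↭)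
open import Data.List.Relation.Binary.Permutation.Propositional using (_↭_; ↭⇒↭ₛ)
open import Data.List.Relation.Binary.Permutation.Propositional.Properties using (↭-length)
open import Data.List.Relation.Binary.Permutation.Setoid.Properties using (foldr-commMonoid)
open import Data.List.Relation.Unary.All as All using (All; []; _∷_)
open import Data.List.Relation.Unary.All.Properties using (all-filter; ¬Any⇒All¬)
import Data.List.Relation.Unary.All.Properties as All
open import Data.List.Relation.Unary.AllPairs as AllPairs using (AllPairs; []; _∷_)
import Data.List.Relation.Unary.AllPairs.Properties as AllPairs
open import Data.List.Relation.Unary.Any as Any using (here; there; any?; index)
open import Data.List.Relation.Unary.Any.Properties using (lookup-index)
open import Data.List.Relation.Unary.Unique.Propositional using (Unique)
import Data.List.Relation.Unary.Unique.Propositional.Properties as Unique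
import Data.Maybe as Maybe
open import Data.Nat as ℕ using (ℕ; zero; suc; _≤_; _<_; z≤n; s≤s; NonZero)
open import Data.Nat.DivMod using (m≡m%n+[m/n]*n; m*n/n≡m)
import Data.Nat.Properties as ℕ
open import Data.Nat.Tactic.RingSolver using (solve-∀)
open import Data.Product using (Σ; ∃; _×_; _,_; proj₁; proj₂)
open import Data.Sign as Sign using (Sign)
open import Data.Sum as Sum using (_⊎_; inj₁; inj₂; [_,_]′)
open import Function using (_∘_)
open import Function.Bundles using (Inverse; Equivalence; mk⇔; _⇔_)
open import Function.Properties.Inverse using (↔⇒↣)
open import Relation.Binary.Definitions using (DecidableEquality)
open import Relation.Binary.PropositionalEquality
  using (_≡_; _≢_; refl; sym; trans; cong; cong₂; subst; setoid; module ≡-Reasoning)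
open import Relation.Nullary using (¬_; Dec; yes; no; ¬?)
open import Relation.Nullary.Decidable using (dec⇒maybe)

open import Defs

unique∧same-elements⇒↭ : {A : Set} {xs ys : List A} → Unique xs → Unique ys →
  (∀ {z} → z ∈ xs → z ∈ ys) → (∀ {z} → z ∈ ys → z ∈ xs) → xs ↭ ys
unique∧same-elements⇒↭ u v to from = ∼bag⇒↭ (unique∧set⇒bag u v (mk⇔ to from))

length-filter+length-filter∁ : {A : Set} {P : A → Set} (P? : (x : A) → Dec (P x)) (xs : List A) →
  length (filter P? xs) ℕ.+ length (filter (¬? ∘ P?) xs) ≡ length xs
length-filter+length-filter∁ P? []       = refl
length-filter+length-filter∁ P? (x ∷ xs) with P? x
... | yes _ = cong suc (length-filter+length-filter∁ P? xs)
... | no  _ = trans (ℕ.+-suc _ _) (cong suc (length-filter+length-filter∁ P? xs))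

module _ {A B : Set} (_≟_ : DecidableEquality B) (h : A → B) {m : ℕ}
         (fibre-bound : ∀ b {ys} → Unique ys → All (λ y → h y ≡ b) ys → length ys ≤ m) where

  length≤|image|*fibre : ∀ bs {xs} → Unique xs → All (λ x → h x ∈ bs) xs → length xs ≤ length bs ℕ.* m
  length≤|image|*fibre []       {[]}    _ _        = z≤n
  length≤|image|*fibre []       {_ ∷ _} _ (() ∷ _)
  length≤|image|*fibre (b ∷ bs) {xs}    u h[xs]⊆ =
    subst (ℕ._≤ m ℕ.+ length bs ℕ.* m) (length-filter+length-filter∁ over-b xs)
      (ℕ.+-mono-≤ (fibre-bound b (Unique.filter⁺ over-b u) (all-filter over-b xs))
                  (length≤|image|*fibre bs (Unique.filter⁺ (¬? ∘ over-b) u)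
                    (All.zipWith in-bs (all-filter (¬? ∘ over-b) xs , All.filter⁺ (¬? ∘ over-b) h[xs]⊆))))
    where
    over-b : (x : A) → Dec (h x ≡ b)
    over-b x = h x ≟ b
    in-bs : ∀ {x} → ¬ h x ≡ b × h x ∈ b ∷ bs → h x ∈ bs
    in-bs (hx≢b , here hx≡b) = ⊥-elim (hx≢b hx≡b)
    in-bs (_    , there hx∈) = hx∈

module Arithmetic where
  open import Data.Nat using (_+_; _*_; _^_; _∸_; _/_; _%_)
  open ≡-Reasoning

  -- The ring solver does not unfold _^_, so both identities are proved in expanded form.
  cube-identity : ∀ p → suc (p * (suc p ^ 2 + suc p + 1)) ≡ suc p ^ 3
  cube-identity = expanded
    where
    expanded : ∀ p → suc (p * (suc p * (suc p * 1) + suc p + 1)) ≡ suc p * (suc p * (suc p * 1))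
    expanded = solve-∀

  odd-cube-identity : ∀ r → let q = suc (2 * r) in suc (2 * (r * (q ^ 2 + q + 1))) ≡ q ^ 3
  odd-cube-identity = expanded
    where
    expanded : ∀ r → suc (2 * (r * (suc (2 * r) * (suc (2 * r) * 1) + suc (2 * r) + 1)))
                     ≡ suc (2 * r) * (suc (2 * r) * (suc (2 * r) * 1))
    expanded = solve-∀

  n%2≡0⇒n≡2*[n/2] : ∀ n → n % 2 ≡ 0 → n ≡ 2 * (n / 2)
  n%2≡0⇒n≡2*[n/2] n n%2≡0 = begin
    n                    ≡⟨ m≡m%n+[m/n]*n n 2 ⟩
    n % 2 + n / 2 * 2    ≡⟨ cong (_+ n / 2 * 2) n%2≡0 ⟩
    n / 2 * 2            ≡⟨ ℕ.*-comm (n / 2) 2 ⟩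
    2 * (n / 2)          ∎

  n%2≡1⇒n≡1+2*[n/2] : ∀ n → n % 2 ≡ 1 → n ≡ suc (2 * (n / 2))
  n%2≡1⇒n≡1+2*[n/2] n n%2≡1 = begin
    n                    ≡⟨ m≡m%n+[m/n]*n n 2 ⟩
    n % 2 + n / 2 * 2    ≡⟨ cong (_+ n / 2 * 2) n%2≡1 ⟩
    suc (n / 2 * 2)      ≡⟨ cong suc (ℕ.*-comm (n / 2) 2) ⟩
    suc (2 * (n / 2))    ∎

  module _ (n r : ℕ) (n≡1+2r : n ≡ suc (2 * r)) where

    n%4≡1⇒r≡2*[n/4] : n % 4 ≡ 1 → r ≡ 2 * (n / 4)
    n%4≡1⇒r≡2*[n/4] n%4≡1 = ℕ.*-cancelˡ-≡ r _ 2 (ℕ.suc-injective (begin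
      suc (2 * r)              ≡⟨ sym n≡1+2r ⟩
      n                        ≡⟨ m≡m%n+[m/n]*n n 4 ⟩
      n % 4 + n / 4 * 4        ≡⟨ cong (_+ n / 4 * 4) n%4≡1 ⟩
      suc (n / 4 * 4)          ≡⟨ cong suc (4j≡2*2j (n / 4)) ⟩
      suc (2 * (2 * (n / 4)))  ∎))
      where
      4j≡2*2j : ∀ j → j * 4 ≡ 2 * (2 * j)
      4j≡2*2j = solve-∀

    n%4≡3⇒r≡1+2*[n/4] : n % 4 ≡ 3 → r ≡ suc (2 * (n / 4))
    n%4≡3⇒r≡1+2*[n/4] n%4≡3 = ℕ.*-cancelˡ-≡ r _ 2 (ℕ.suc-injective (begin
      suc (2 * r)                  ≡⟨ sym n≡1+2r ⟩
      n                            ≡⟨ m≡m%n+[m/n]*n n 4 ⟩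
      n % 4 + n / 4 * 4            ≡⟨ cong (_+ n / 4 * 4) n%4≡3 ⟩
      3 + n / 4 * 4                ≡⟨ 3+4j≡1+2[1+2j] (n / 4) ⟩
      suc (2 * suc (2 * (n / 4)))  ∎))
      where
      3+4j≡1+2[1+2j] : ∀ j → 3 + j * 4 ≡ suc (2 * suc (2 * j))
      3+4j≡1+2[1+2j] = solve-∀

    [n∸1]/2≡r : (n ∸ 1) / 2 ≡ r
    [n∸1]/2≡r = begin
      (n ∸ 1) / 2   ≡⟨ cong (λ m → (m ∸ 1) / 2) n≡1+2r ⟩
      (2 * r) / 2   ≡⟨ cong (_/ 2) (ℕ.*-comm 2 r) ⟩
      (r * 2) / 2   ≡⟨ m*n/n≡m r 2 ⟩
      r             ∎

    [n+1]/2≡1+r : (n + 1) / 2 ≡ suc r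
    [n+1]/2≡1+r = begin
      (n + 1) / 2           ≡⟨ cong (λ m → (m + 1) / 2) n≡1+2r ⟩
      (suc (2 * r) + 1) / 2 ≡⟨ cong (_/ 2) (1+2r+1≡[1+r]*2 r) ⟩
      (suc r * 2) / 2       ≡⟨ m*n/n≡m (suc r) 2 ⟩
      suc r                 ∎
      where
      1+2r+1≡[1+r]*2 : ∀ r → suc (2 * r) + 1 ≡ suc r * 2
      1+2r+1≡[1+r]*2 = solve-∀

open Arithmetic

module FiniteFieldTheory {n : ℕ} (F : FiniteField n) where
  open FiniteField F public

  commutativeRing : CommutativeRing 0ℓ 0ℓ
  commutativeRing = record { isCommutativeRing = isCommRing }

  open CommutativeRing commutativeRing public
    using ( +-assoc; +-comm; +-identityˡ; +-identityʳ; -‿inverseˡ; -‿inverseʳ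
          ; *-assoc; *-comm; *-identityˡ; *-identityʳ; zeroˡ; zeroʳ
          ; +-isCommutativeMonoid; *-isCommutativeMonoid; ring; semiring; commutativeSemiring)
  open RingProperties ring public using (-‿distribˡ-*; -‿involutive; -0#≈0#; -‿+-comm)
  open SemiringMult semiring public using (×1-homo-*) renaming (_×_ to _×′_)
  open MonoidMult (CommutativeRing.+-monoid commutativeRing) public using (×-homo-+; 1+×)
  open SemiringExp semiring public using (_^_; ^-homo-*; ^-assocʳ)
  open CommutativeSemiringExp commutativeSemiring public using (^-distrib-*)

  infix 4 _≟_
  _≟_ : DecidableEquality Carrier
  _≟_ = inj⇒≟ (↔⇒↣ enum)

  -- Ring solver for F with integer coefficients: they are interpreted through the canonical
  -- map ℤ → F, so that coefficient arithmetic computes and normal forms can be compared by refl.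
  private
    sign : Sign → Carrier
    sign Sign.+ = 1#
    sign Sign.- = - 1#

    sign-* : ∀ s t → sign (s Sign.* t) ≡ sign s * sign t
    sign-* Sign.+ t = sym (*-identityˡ _)
    sign-* Sign.- Sign.+ = sym (*-identityʳ _)
    sign-* Sign.- Sign.- = begin
      1#              ≡⟨ sym (-‿involutive 1#) ⟩
      - (- 1#)        ≡⟨ cong -_ (sym (*-identityˡ (- 1#))) ⟩
      - (1# * - 1#)   ≡⟨ -‿distribˡ-* 1# (- 1#) ⟩
      - 1# * - 1#     ∎
      where open ≡-Reasoning

    cancel-1 : ∀ a b → (1# + a) + - (1# + b) ≡ a + - b
    cancel-1 a b = begin
      (1# + a) + - (1# + b)      ≡⟨ cong₂ _+_ (+-comm 1# a) (sym (-‿+-comm 1# b)) ⟩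
      (a + 1#) + (- 1# + - b)    ≡⟨ +-assoc a 1# _ ⟩
      a + (1# + (- 1# + - b))    ≡⟨ cong (a +_) (sym (+-assoc 1# (- 1#) (- b))) ⟩
      a + ((1# + - 1#) + - b)    ≡⟨ cong (λ z → a + (z + - b)) (-‿inverseʳ 1#) ⟩
      a + (0# + - b)             ≡⟨ cong (a +_) (+-identityˡ (- b)) ⟩
      a + - b                    ∎
      where open ≡-Reasoning

    ⟦_⟧ℤ : ℤ → Carrier
    ⟦ ℤ.+ k ⟧ℤ    = k ×′ 1#
    ⟦ -[1+ k ] ⟧ℤ = - (suc k ×′ 1#)

    ⟦⊖⟧ : ∀ i j → ⟦ i ℤ.⊖ j ⟧ℤ ≡ i ×′ 1# + - (j ×′ 1#)
    ⟦⊖⟧ zero    zero    = sym (trans (+-identityˡ _) -0#≈0#)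
    ⟦⊖⟧ zero    (suc j) = sym (+-identityˡ _)
    ⟦⊖⟧ (suc i) zero    = sym (trans (cong (suc i ×′ 1# +_) -0#≈0#) (+-identityʳ _))
    ⟦⊖⟧ (suc i) (suc j) = begin
      ⟦ suc i ℤ.⊖ suc j ⟧ℤ                      ≡⟨ cong ⟦_⟧ℤ (ℤ.[1+m]⊖[1+n]≡m⊖n i j) ⟩
      ⟦ i ℤ.⊖ j ⟧ℤ                              ≡⟨ ⟦⊖⟧ i j ⟩
      i ×′ 1# + - (j ×′ 1#)                     ≡⟨ sym (cancel-1 _ _) ⟩
      (1# + i ×′ 1#) + - (1# + j ×′ 1#)         ≡⟨ sym (cong₂ (λ a b → a + - b) (1+× i 1#) (1+× j 1#)) ⟩
      suc i ×′ 1# + - (suc j ×′ 1#)             ∎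
      where open ≡-Reasoning

    ⟦+⟧ : ∀ i j → ⟦ i ℤ.+ j ⟧ℤ ≡ ⟦ i ⟧ℤ + ⟦ j ⟧ℤ
    ⟦+⟧ -[1+ i ] -[1+ j ] = trans (cong -_ (trans (cong (λ k → suc k ×′ 1#) (sym (ℕ.+-suc i j)))
                                                  (×-homo-+ 1# (suc i) (suc j))))
                                  (sym (-‿+-comm _ _))
    ⟦+⟧ -[1+ i ] (ℤ.+ j)  = trans (⟦⊖⟧ j (suc i)) (+-comm _ _)
    ⟦+⟧ (ℤ.+ i)  -[1+ j ] = ⟦⊖⟧ i (suc j)
    ⟦+⟧ (ℤ.+ i)  (ℤ.+ j)  = ×-homo-+ 1# i j

    ⟦-⟧ : ∀ i → ⟦ ℤ.- i ⟧ℤ ≡ - ⟦ i ⟧ℤ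
    ⟦-⟧ -[1+ i ]       = sym (-‿involutive _)
    ⟦-⟧ (ℤ.+ zero)     = sym -0#≈0#
    ⟦-⟧ (ℤ.+ suc i)    = refl

    ⟦◃⟧ : ∀ s k → ⟦ s ℤ.◃ k ⟧ℤ ≡ sign s * k ×′ 1#
    ⟦◃⟧ s       zero    = sym (zeroʳ _)
    ⟦◃⟧ Sign.+ (suc k) = sym (*-identityˡ _)
    ⟦◃⟧ Sign.- (suc k) = trans (cong -_ (sym (*-identityˡ _))) (-‿distribˡ-* 1# _)

    ⟦sign◃abs⟧ : ∀ i → ⟦ i ⟧ℤ ≡ sign (ℤ.sign i) * ℤ.∣ i ∣ ×′ 1#
    ⟦sign◃abs⟧ i = trans (cong ⟦_⟧ℤ (sym (ℤ.◃-inverse i))) (⟦◃⟧ (ℤ.sign i) ℤ.∣ i ∣)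

    ⟦*⟧ : ∀ i j → ⟦ i ℤ.* j ⟧ℤ ≡ ⟦ i ⟧ℤ * ⟦ j ⟧ℤ
    ⟦*⟧ i j = begin
      ⟦ i ℤ.* j ⟧ℤ                                 ≡⟨ ⟦◃⟧ (ℤ.sign i Sign.* ℤ.sign j) (ℤ.∣ i ∣ ℕ.* ℤ.∣ j ∣) ⟩
      sign (ℤ.sign i Sign.* ℤ.sign j) * (ℤ.∣ i ∣ ℕ.* ℤ.∣ j ∣) ×′ 1#
        ≡⟨ cong₂ _*_ (sign-* (ℤ.sign i) (ℤ.sign j)) (×1-homo-* ℤ.∣ i ∣ ℤ.∣ j ∣) ⟩
      (a * b) * (c * d)                            ≡⟨ interchange a b c d ⟩
      (a * c) * (b * d)                            ≡⟨ cong₂ _*_ (sym (⟦sign◃abs⟧ i)) (sym (⟦sign◃abs⟧ j)) ⟩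
      ⟦ i ⟧ℤ * ⟦ j ⟧ℤ                              ∎
      where
      open ≡-Reasoning
      a = sign (ℤ.sign i)
      b = sign (ℤ.sign j)
      c = ℤ.∣ i ∣ ×′ 1#
      d = ℤ.∣ j ∣ ×′ 1#
      interchange : ∀ a b c d → (a * b) * (c * d) ≡ (a * c) * (b * d)
      interchange a b c d = begin
        (a * b) * (c * d)  ≡⟨ *-assoc a b _ ⟩
        a * (b * (c * d))  ≡⟨ cong (a *_) (sym (*-assoc b c d)) ⟩
        a * ((b * c) * d)  ≡⟨ cong (λ z → a * (z * d)) (*-comm b c) ⟩
        a * ((c * b) * d)  ≡⟨ cong (a *_) (*-assoc c b d) ⟩
        a * (c * (b * d))  ≡⟨ sym (*-assoc a c _) ⟩
        (a * c) * (b * d)  ∎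

    ℤ-morphism : ℤ.+-*-rawRing ACR.-Raw-AlmostCommutative⟶ ACR.fromCommutativeRing commutativeRing
    ℤ-morphism = record
      { ⟦_⟧ = ⟦_⟧ℤ ; +-homo = ⟦+⟧ ; *-homo = ⟦*⟧ ; -‿homo = ⟦-⟧ ; 0-homo = refl ; 1-homo = refl }

  open Algebra.Solver.Ring ℤ.+-*-rawRing (ACR.fromCommutativeRing commutativeRing) ℤ-morphism
    (λ i j → Maybe.map (cong ⟦_⟧ℤ) (dec⇒maybe (i ℤ.≟ j))) public
    using (Polynomial; solve; _:=_; _:+_; _:*_; :-_; _:-_; con)

  :0 :1 : ∀ {m} → Polynomial m
  :0 = con (ℤ.+ 0)
  :1 = con (ℤ.+ 1)

  1#≢0# : 1# ≢ 0#
  1#≢0# = 0≢1 ∘ sym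

  inv : (x : Carrier) → x ≢ 0# → Carrier
  inv x x≢0 = proj₁ (inverse x x≢0)

  module _ {x : Carrier} (x≢0 : x ≢ 0#) where

    *-inverseʳ : x * inv x x≢0 ≡ 1#
    *-inverseʳ = proj₂ (inverse x x≢0)

    *-inverseˡ : inv x x≢0 * x ≡ 1#
    *-inverseˡ = trans (*-comm _ x) *-inverseʳ

    *-cancelˡ : ∀ {a b} → x * a ≡ x * b → a ≡ b
    *-cancelˡ {a} {b} xa≡xb = begin
      a                    ≡⟨ sym (*-identityˡ a) ⟩
      1# * a               ≡⟨ cong (_* a) (sym *-inverseˡ) ⟩
      (inv x x≢0 * x) * a  ≡⟨ *-assoc _ x a ⟩
      inv x x≢0 * (x * a)  ≡⟨ cong (inv x x≢0 *_) xa≡xb ⟩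
      inv x x≢0 * (x * b)  ≡⟨ sym (*-assoc _ x b) ⟩
      (inv x x≢0 * x) * b  ≡⟨ cong (_* b) *-inverseˡ ⟩
      1# * b               ≡⟨ *-identityˡ b ⟩
      b                    ∎
      where open ≡-Reasoning

    a*x⁻¹*x≡a : ∀ {a} → (a * inv x x≢0) * x ≡ a
    a*x⁻¹*x≡a {a} = trans (*-assoc a _ x) (trans (cong (a *_) *-inverseˡ) (*-identityʳ a))

    inv-nonzero : inv x x≢0 ≢ 0#
    inv-nonzero i≡0 = 1#≢0# (trans (sym *-inverseʳ) (trans (cong (x *_) i≡0) (zeroʳ x)))

  x*y≡0⇒x≡0⊎y≡0 : ∀ {x y} → x * y ≡ 0# → x ≡ 0# ⊎ y ≡ 0#
  x*y≡0⇒x≡0⊎y≡0 {x} {y} xy≡0 with x ≟ 0#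
  ... | yes x≡0 = inj₁ x≡0
  ... | no  x≢0 = inj₂ (*-cancelˡ x≢0 (trans xy≡0 (sym (zeroʳ x))))

  x*y≢0 : ∀ {x y} → x ≢ 0# → y ≢ 0# → x * y ≢ 0#
  x*y≢0 x≢0 y≢0 xy≡0 with x*y≡0⇒x≡0⊎y≡0 xy≡0
  ... | inj₁ x≡0 = x≢0 x≡0
  ... | inj₂ y≡0 = y≢0 y≡0

  x≢0∧x*y≡0⇒y≡0 : ∀ {x y} → x ≢ 0# → x * y ≡ 0# → y ≡ 0#
  x≢0∧x*y≡0⇒y≡0 {x} x≢0 xy≡0 = *-cancelˡ x≢0 (trans xy≡0 (sym (zeroʳ x)))

  x+y≡0⇒x≡-y : ∀ {x y} → x + y ≡ 0# → x ≡ - y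
  x+y≡0⇒x≡-y {x} {y} x+y≡0 = begin
    x                ≡⟨ solve 2 (λ x y → x := (x :+ y) :- y) refl x y ⟩
    (x + y) + - y    ≡⟨ cong (_+ - y) x+y≡0 ⟩
    0# + - y         ≡⟨ +-identityˡ (- y) ⟩
    - y              ∎
    where open ≡-Reasoning

  x-y≡0⇒x≡y : ∀ {x y} → x + - y ≡ 0# → x ≡ y
  x-y≡0⇒x≡y {x} {y} x-y≡0 = trans (x+y≡0⇒x≡-y x-y≡0) (-‿involutive y)

  x²≡1⇒x≡±1 : ∀ {x} → x * x ≡ 1# → x ≡ 1# ⊎ x ≡ - 1#
  x²≡1⇒x≡±1 {x} x²≡1 with x*y≡0⇒x≡0⊎y≡0 (trans factor (trans (cong (_+ - 1#) x²≡1) (-‿inverseʳ 1#)))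
    where
    factor : (x + - 1#) * (x + 1#) ≡ x * x + - 1#
    factor = solve 1 (λ x → (x :- :1) :* (x :+ :1) := x :* x :- :1) refl x
  ... | inj₁ x-1≡0 = inj₁ (x-y≡0⇒x≡y x-1≡0)
  ... | inj₂ x+1≡0 = inj₂ (x+y≡0⇒x≡-y x+1≡0)

  -1*-1≡1 : - 1# * - 1# ≡ 1#
  -1*-1≡1 = solve 0 (:- :1 :* :- :1 := :1) refl

  ^-nonzero : ∀ {x} k → x ≢ 0# → x ^ k ≢ 0#
  ^-nonzero zero    x≢0 = 1#≢0#
  ^-nonzero (suc k) x≢0 = x*y≢0 x≢0 (^-nonzero k x≢0)

  0^k≢1 : ∀ k .{{_ : NonZero k}} → 0# ^ k ≢ 1#
  0^k≢1 (suc k) 0^k≡1 = 1#≢0# (trans (sym 0^k≡1) (zeroˡ _))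

  1^k≡1 : ∀ k → 1# ^ k ≡ 1#
  1^k≡1 zero    = refl
  1^k≡1 (suc k) = trans (*-identityˡ _) (1^k≡1 k)

  -1^2k≡1 : ∀ k → (- 1#) ^ (2 ℕ.* k) ≡ 1#
  -1^2k≡1 k = trans (sym (^-assocʳ (- 1#) 2 k)) (trans (cong (_^ k) square) (1^k≡1 k))
    where
    square : (- 1#) ^ 2 ≡ 1#
    square = trans (cong (- 1# *_) (*-identityʳ (- 1#))) -1*-1≡1

  -1^[1+2k]≡-1 : ∀ k → (- 1#) ^ suc (2 ℕ.* k) ≡ - 1#
  -1^[1+2k]≡-1 k = trans (cong (- 1# *_) (-1^2k≡1 k)) (*-identityʳ (- 1#))

  elements : List Carrier
  elements = tabulate (Inverse.from enum)

  ∈-elements : ∀ x → x ∈ elements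
  ∈-elements x = subst (_∈ elements) (Inverse.strictlyInverseʳ enum x) (∈-tabulate⁺ (Inverse.to enum x))

  elements-unique : Unique elements
  elements-unique = Unique.tabulate⁺ λ {i} {j} from-i≡from-j →
    trans (sym (Inverse.strictlyInverseˡ enum i))
          (trans (cong (Inverse.to enum) from-i≡from-j) (Inverse.strictlyInverseˡ enum j))

  length-elements : length elements ≡ n
  length-elements = length-tabulate (Inverse.from enum)

  units : List Carrier
  units = filter (λ x → ¬? (x ≟ 0#)) elements

  ∈-units : ∀ {x} → x ≢ 0# → x ∈ units
  ∈-units {x} = ∈-filter⁺ (λ x → ¬? (x ≟ 0#)) (∈-elements x)

  ∈-units⁻ : ∀ {x} → x ∈ units → x ≢ 0#
  ∈-units⁻ = proj₂ ∘ ∈-filter⁻ (λ x → ¬? (x ≟ 0#)) {xs = elements}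

  units-unique : Unique units
  units-unique = Unique.filter⁺ (λ x → ¬? (x ≟ 0#)) elements-unique

  suc-length-units : suc (length units) ≡ n
  suc-length-units = trans (sym (↭-length elements↭0∷units)) length-elements
    where
    elements↭0∷units : elements ↭ 0# ∷ units
    elements↭0∷units = unique∧same-elements⇒↭ elements-unique
      (All.tabulate (λ x∈units 0≡x → ∈-units⁻ x∈units (sym 0≡x)) ∷ units-unique)
      (λ {x} _ → case-zero x) (λ {x} _ → ∈-elements x)
      where
      case-zero : ∀ x → x ∈ 0# ∷ units
      case-zero x with x ≟ 0#
      ... | yes x≡0 = here x≡0
      ... | no  x≢0 = there (∈-units x≢0)

  2≤n : 2 ≤ n
  2≤n = subst (2 ≤_) suc-length-units (s≤s (∈-length (∈-units 1#≢0#)))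

  product : List Carrier → Carrier
  product = foldr _*_ 1#

  sum : List Carrier → Carrier
  sum = foldr _+_ 0#

  product-↭ : ∀ {xs ys} → xs ↭ ys → product xs ≡ product ys
  product-↭ p = foldr-commMonoid (setoid Carrier) *-isCommutativeMonoid (↭⇒↭ₛ p)

  sum-↭ : ∀ {xs ys} → xs ↭ ys → sum xs ≡ sum ys
  sum-↭ p = foldr-commMonoid (setoid Carrier) +-isCommutativeMonoid (↭⇒↭ₛ p)

  product≢0 : ∀ {xs} → All (_≢ 0#) xs → product xs ≢ 0#
  product≢0 []           = 1#≢0#
  product≢0 (x≢0 ∷ xs≢0) = x*y≢0 x≢0 (product≢0 xs≢0)

  product-map-* : ∀ x xs → product (map (x *_) xs) ≡ x ^ length xs * product xs
  product-map-* x []       = sym (*-identityˡ 1#)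
  product-map-* x (y ∷ xs) = trans (cong (x * y *_) (product-map-* x xs))
    (solve 4 (λ x y p q → (x :* y) :* (p :* q) := (x :* p) :* (y :* q)) refl x y (x ^ length xs) (product xs))

  sum-map-+1 : ∀ xs → sum (map (_+ 1#) xs) ≡ sum xs + length xs ×′ 1#
  sum-map-+1 []       = sym (+-identityʳ 0#)
  sum-map-+1 (y ∷ xs) = begin
    (y + 1#) + sum (map (_+ 1#) xs)            ≡⟨ cong ((y + 1#) +_) (sum-map-+1 xs) ⟩
    (y + 1#) + (sum xs + length xs ×′ 1#)      ≡⟨ solve 3 (λ y s k → (y :+ :1) :+ (s :+ k) := (y :+ s) :+ (:1 :+ k)) refl y (sum xs) _ ⟩
    (y + sum xs) + (1# + length xs ×′ 1#)      ≡⟨ cong ((y + sum xs) +_) (sym (1+× (length xs) 1#)) ⟩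
    (y + sum xs) + suc (length xs) ×′ 1#       ∎
    where open ≡-Reasoning

  map-*-units↭units : ∀ {x} → x ≢ 0# → map (x *_) units ↭ units
  map-*-units↭units {x} x≢0 = unique∧same-elements⇒↭
    (Unique.map⁺ (*-cancelˡ x≢0) units-unique) units-unique
    (λ z∈ → let (y , y∈ , z≡xy) = ∈-map⁻ (x *_) z∈ in
            subst (_∈ units) (sym z≡xy) (∈-units (x*y≢0 x≢0 (∈-units⁻ y∈))))
    (λ {z} z∈ → subst (_∈ map (x *_) units) (x[x⁻¹z]≡z z)
                      (∈-map⁺ (x *_) (∈-units (x*y≢0 (inv-nonzero x≢0) (∈-units⁻ z∈)))))
    where
    x[x⁻¹z]≡z : ∀ z → x * (inv x x≢0 * z) ≡ z
    x[x⁻¹z]≡z z = trans (sym (*-assoc x _ z)) (trans (cong (_* z) (*-inverseʳ x≢0)) (*-identityˡ z))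

  map-+1-elements↭elements : map (_+ 1#) elements ↭ elements
  map-+1-elements↭elements = unique∧same-elements⇒↭
    (Unique.map⁺ +1-injective elements-unique) elements-unique
    (λ {z} _ → ∈-elements z)
    (λ {z} _ → subst (_∈ map (_+ 1#) elements) (solve 1 (λ z → (z :- :1) :+ :1 := z) refl z)
                     (∈-map⁺ (_+ 1#) (∈-elements (z + - 1#))))
    where
    +1-injective : ∀ {a b} → a + 1# ≡ b + 1# → a ≡ b
    +1-injective {a} {b} a+1≡b+1 = x-y≡0⇒x≡y (begin
      a + - b                    ≡⟨ solve 2 (λ a b → a :- b := (a :+ :1) :- (b :+ :1)) refl a b ⟩
      (a + 1#) + - (b + 1#)      ≡⟨ cong (λ z → z + - (b + 1#)) a+1≡b+1 ⟩
      (b + 1#) + - (b + 1#)      ≡⟨ -‿inverseʳ (b + 1#) ⟩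
      0#                         ∎)
      where open ≡-Reasoning

  x^|units|≡1 : ∀ {x} → x ≢ 0# → x ^ length units ≡ 1#
  x^|units|≡1 {x} x≢0 = *-cancelˡ product-units≢0 (begin
    product units * x ^ length units   ≡⟨ *-comm _ _ ⟩
    x ^ length units * product units   ≡⟨ sym (product-map-* x units) ⟩
    product (map (x *_) units)         ≡⟨ product-↭ (map-*-units↭units x≢0) ⟩
    product units                      ≡⟨ sym (*-identityʳ _) ⟩
    product units * 1#                 ∎)
    where
    open ≡-Reasoning
    product-units≢0 : product units ≢ 0#
    product-units≢0 = product≢0 (All.tabulate ∈-units⁻)

  x^[n-1]≡1 : ∀ {m x} → suc m ≡ n → x ≢ 0# → x ^ m ≡ 1#
  x^[n-1]≡1 {m} 1+m≡n x≢0 =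
    subst (λ k → _ ^ k ≡ 1#) (ℕ.suc-injective (trans suc-length-units (sym 1+m≡n))) (x^|units|≡1 x≢0)

  x^n≡x : ∀ x → x ^ n ≡ x
  x^n≡x x with x ≟ 0#
  ... | yes refl = subst (λ k → 0# ^ k ≡ 0#) suc-length-units (zeroˡ _)
  ... | no  x≢0  = subst (λ k → x ^ k ≡ x) suc-length-units
                     (trans (cong (x *_) (x^|units|≡1 x≢0)) (*-identityʳ x))

  n×1≡0 : n ×′ 1# ≡ 0#
  n×1≡0 = begin
    n ×′ 1#                                          ≡⟨ solve 2 (λ s k → k := (s :+ k) :- s) refl (sum elements) _ ⟩
    (sum elements + n ×′ 1#) + - sum elements        ≡⟨ cong (λ k → (sum elements + k ×′ 1#) + - sum elements) (sym length-elements) ⟩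
    (sum elements + length elements ×′ 1#) + - sum elements
                                                     ≡⟨ cong (_+ - sum elements) (sym (sum-map-+1 elements)) ⟩
    sum (map (_+ 1#) elements) + - sum elements      ≡⟨ cong (_+ - sum elements) (sum-↭ map-+1-elements↭elements) ⟩
    sum elements + - sum elements                    ≡⟨ -‿inverseʳ (sum elements) ⟩
    0#                                               ∎
    where open ≡-Reasoning

  1+1≢0-if-odd : ∀ {k} → n ≡ suc (2 ℕ.* k) → 1# + 1# ≢ 0#
  1+1≢0-if-odd {k} n≡1+2k 1+1≡0 = 1#≢0# (begin
    1#                              ≡⟨ sym (+-identityʳ 1#) ⟩
    1# + 0#                         ≡⟨ cong (1# +_) (sym (zeroˡ (k ×′ 1#))) ⟩
    1# + 0# * k ×′ 1#               ≡⟨ cong (λ z → 1# + z * k ×′ 1#) (sym 1+1≡0) ⟩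
    1# + (1# + 1#) * k ×′ 1#        ≡⟨ cong (1# +_) (sym (×1-homo-* 2 k)) ⟩
    1# + (2 ℕ.* k) ×′ 1#            ≡⟨ sym (1+× (2 ℕ.* k) 1#) ⟩
    suc (2 ℕ.* k) ×′ 1#             ≡⟨ cong (_×′ 1#) (sym n≡1+2k) ⟩
    n ×′ 1#                         ≡⟨ n×1≡0 ⟩
    0#                              ∎)
    where open ≡-Reasoning

  -- evalMonic (c₀ ∷ … ∷ c_{d−1}) x = c₀ + c₁ x + … + c_{d−1} x^{d−1} + x^d
  evalMonic : List Carrier → Carrier → Carrier
  evalMonic []       x = 1#
  evalMonic (c ∷ cs) x = c + x * evalMonic cs x

  quotient : Carrier → List Carrier → List Carrier
  quotient r []       = []
  quotient r (c ∷ cs) = evalMonic (c ∷ cs) r ∷ quotient r cs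

  length-quotient : ∀ r cs → length (quotient r cs) ≡ length cs
  length-quotient r []       = refl
  length-quotient r (c ∷ cs) = cong suc (length-quotient r cs)

  evalMonic-factor : ∀ c cs x r →
    evalMonic (c ∷ cs) x ≡ evalMonic (c ∷ cs) r + (x + - r) * evalMonic (quotient r cs) x
  evalMonic-factor c []        x r =
    solve 3 (λ c x r → c :+ x :* :1 := (c :+ r :* :1) :+ (x :- r) :* :1) refl c x r
  evalMonic-factor c (c′ ∷ cs) x r = trans (cong (λ z → c + x * z) (evalMonic-factor c′ cs x r))
    (solve 5 (λ c x r a w → c :+ x :* (a :+ (x :- r) :* w) := (c :+ r :* a) :+ (x :- r) :* (a :+ x :* w))
           refl c x r (evalMonic (c′ ∷ cs) r) (evalMonic (quotient r cs) x))

  length-roots≤degree : ∀ cs {rs} → Unique rs → All (λ r → evalMonic cs r ≡ 0#) rs → length rs ≤ length cs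
  length-roots≤degree cs       {[]}     _        _          = z≤n
  length-roots≤degree []       {r ∷ rs} _        (1≡0 ∷ _)  = ⊥-elim (1#≢0# 1≡0)
  length-roots≤degree (c ∷ cs) {r ∷ rs} (r∉ ∷ u) (root ∷ roots) =
    s≤s (subst (length rs ≤_) (length-quotient r cs)
          (length-roots≤degree (quotient r cs) u (All.zipWith root-of-quotient (r∉ , roots))))
    where
    root-of-quotient : ∀ {s} → r ≢ s × evalMonic (c ∷ cs) s ≡ 0# → evalMonic (quotient r cs) s ≡ 0#
    root-of-quotient {s} (r≢s , root-s) with x*y≡0⇒x≡0⊎y≡0 (begin
      (s + - r) * evalMonic (quotient r cs) s                         ≡⟨ sym (+-identityˡ _) ⟩
      0# + (s + - r) * evalMonic (quotient r cs) s                    ≡⟨ cong (λ z → z + (s + - r) * evalMonic (quotient r cs) s) (sym root) ⟩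
      evalMonic (c ∷ cs) r + (s + - r) * evalMonic (quotient r cs) s  ≡⟨ sym (evalMonic-factor c cs s r) ⟩
      evalMonic (c ∷ cs) s                                            ≡⟨ root-s ⟩
      0#                                                              ∎)
      where open ≡-Reasoning
    ... | inj₁ s-r≡0 = ⊥-elim (r≢s (sym (x-y≡0⇒x≡y s-r≡0)))
    ... | inj₂ q[s]≡0 = q[s]≡0

  evalMonic-replicate-0 : ∀ d x → evalMonic (replicate d 0#) x ≡ x ^ d
  evalMonic-replicate-0 zero    x = refl
  evalMonic-replicate-0 (suc d) x = trans (+-identityˡ _) (cong (x *_) (evalMonic-replicate-0 d x))

  length-solutions-^≤ : ∀ e .{{_ : NonZero e}} b {ys} → Unique ys → All (λ y → y ^ e ≡ b) ys → length ys ≤ e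
  length-solutions-^≤ (suc d) b {ys} u ys^e≡b =
    subst (length ys ≤_) (cong suc (length-replicate d))
      (length-roots≤degree (- b ∷ replicate d 0#) u (All.map root ys^e≡b))
    where
    root : ∀ {y} → y ^ suc d ≡ b → - b + y * evalMonic (replicate d 0#) y ≡ 0#
    root {y} y^e≡b = trans (cong (λ z → - b + y * z) (evalMonic-replicate-0 d y))
                           (trans (cong (- b +_) y^e≡b) (-‿inverseˡ b))

  rootsOfUnity : ℕ → List Carrier
  rootsOfUnity f = filter (λ w → w ^ f ≟ 1#) elements

  module _ (f : ℕ) where

    ∈-rootsOfUnity : ∀ {w} → w ^ f ≡ 1# → w ∈ rootsOfUnity f
    ∈-rootsOfUnity {w} = ∈-filter⁺ (λ w → w ^ f ≟ 1#) (∈-elements w)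

    ∈-rootsOfUnity⁻ : ∀ {w} → w ∈ rootsOfUnity f → w ^ f ≡ 1#
    ∈-rootsOfUnity⁻ = proj₂ ∘ ∈-filter⁻ (λ w → w ^ f ≟ 1#) {xs = elements}

    rootsOfUnity-unique : Unique (rootsOfUnity f)
    rootsOfUnity-unique = Unique.filter⁺ (λ w → w ^ f ≟ 1#) elements-unique

  -- x ↦ x^e sends the e f units into the f-th roots of unity with fibres of size at most e,
  -- so counting makes both the image and the set of roots of unity as large as possible.
  module PowerMap (e f : ℕ) (1+ef≡n : suc (e ℕ.* f) ≡ n) where

    private
      instance
        ef≢0 : NonZero (e ℕ.* f)
        ef≢0 = ℕ.>-nonZero (ℕ.≤-pred (subst (2 ≤_) (sym 1+ef≡n) 2≤n))
        e≢0 : NonZero e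
        e≢0 = ℕ.m*n≢0⇒m≢0 e
        f≢0 : NonZero f
        f≢0 = ℕ.m*n≢0⇒n≢0 e

      ^e-into-rootsOfUnity : ∀ {x} → x ≢ 0# → (x ^ e) ^ f ≡ 1#
      ^e-into-rootsOfUnity {x} x≢0 = trans (^-assocʳ x e f) (x^[n-1]≡1 1+ef≡n x≢0)

      ef≤|R|*e : ∀ R → (∀ {x} → x ≢ 0# → x ^ e ∈ R) → e ℕ.* f ≤ length R ℕ.* e
      ef≤|R|*e R ^e∈R = subst (ℕ._≤ length R ℕ.* e) (ℕ.suc-injective (trans suc-length-units (sym 1+ef≡n)))
        (length≤|image|*fibre _≟_ (_^ e) (length-solutions-^≤ e) R units-unique
          (All.tabulate (^e∈R ∘ ∈-units⁻)))

    length-rootsOfUnity : length (rootsOfUnity f) ≡ f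
    length-rootsOfUnity = ℕ.≤-antisym
      (length-solutions-^≤ f 1# (rootsOfUnity-unique f) (All.tabulate (∈-rootsOfUnity⁻ f)))
      (ℕ.*-cancelʳ-≤ f (length (rootsOfUnity f)) e
        (subst (ℕ._≤ length (rootsOfUnity f) ℕ.* e) (ℕ.*-comm e f)
          (ef≤|R|*e (rootsOfUnity f) (∈-rootsOfUnity f ∘ ^e-into-rootsOfUnity))))

    ^-onto-rootsOfUnity : ∀ {w} → w ^ f ≡ 1# → ∃ λ x → x ≢ 0# × x ^ e ≡ w
    ^-onto-rootsOfUnity {w} w^f≡1 with any? (λ x → x ^ e ≟ w) units
    ... | yes hit = let (x , x∈ , x^e≡w) = find hit in x , ∈-units⁻ x∈ , x^e≡w
    ... | no miss = ⊥-elim (ℕ.<⇒≱ |R′|*e<ef (ef≤|R|*e R′ into-R′))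
      where
      R′ = filter (λ v → ¬? (v ≟ w)) (rootsOfUnity f)
      into-R′ : ∀ {x} → x ≢ 0# → x ^ e ∈ R′
      into-R′ x≢0 = ∈-filter⁺ (λ v → ¬? (v ≟ w)) (∈-rootsOfUnity f (^e-into-rootsOfUnity x≢0))
        (λ x^e≡w → All.lookup (¬Any⇒All¬ units miss) (∈-units x≢0) x^e≡w)
      |R′|<f : length R′ < f
      |R′|<f = subst (length R′ <_) length-rootsOfUnity
        (filter-notAll (λ v → ¬? (v ≟ w)) (rootsOfUnity f)
          (Any.map (λ w≡v v≢w → v≢w (sym w≡v)) (∈-rootsOfUnity f w^f≡1)))
      |R′|*e<ef : length R′ ℕ.* e < e ℕ.* f
      |R′|*e<ef = subst (length R′ ℕ.* e <_) (ℕ.*-comm f e) (ℕ.*-monoˡ-< e |R′|<f)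

module FrobeniusNorm (q : ℕ) (F : FiniteField (q ℕ.^ 3)) where
  open FiniteFieldTheory F public
  open Plane q F public

  K : ℕ
  K = q ℕ.^ 2 ℕ.+ q ℕ.+ 1

  1<q : 1 < q
  1<q = 2≤m³⇒1<m q 2≤n
    where
    2≤m³⇒1<m : ∀ m → 2 ≤ m ℕ.^ 3 → 1 < m
    2≤m³⇒1<m (suc (suc m)) _ = s≤s (s≤s z≤n)
    2≤m³⇒1<m (suc zero) (s≤s ())

  pow≡^ : ∀ x k → pow x k ≡ x ^ k
  pow≡^ x zero    = refl
  pow≡^ x (suc k) = cong (x *_) (pow≡^ x k)

  pow-+ : ∀ x i j → pow x (i ℕ.+ j) ≡ pow x i * pow x j
  pow-+ x i j = trans (pow≡^ x (i ℕ.+ j)) (trans (^-homo-* x i j) (sym (cong₂ _*_ (pow≡^ x i) (pow≡^ x j))))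

  pow-pow : ∀ x i j → pow (pow x i) j ≡ pow x (i ℕ.* j)
  pow-pow x i j = begin
    pow (pow x i) j  ≡⟨ pow≡^ (pow x i) j ⟩
    pow x i ^ j      ≡⟨ cong (_^ j) (pow≡^ x i) ⟩
    (x ^ i) ^ j      ≡⟨ ^-assocʳ x i j ⟩
    x ^ (i ℕ.* j)    ≡⟨ sym (pow≡^ x (i ℕ.* j)) ⟩
    pow x (i ℕ.* j)  ∎
    where open ≡-Reasoning

  pow-comm : ∀ x i j → pow (pow x i) j ≡ pow (pow x j) i
  pow-comm x i j = trans (pow-pow x i j) (trans (cong (pow x) (ℕ.*-comm i j)) (sym (pow-pow x j i)))

  pow-distrib-* : ∀ k x y → pow (x * y) k ≡ pow x k * pow y k
  pow-distrib-* k x y = trans (pow≡^ (x * y) k) (trans (^-distrib-* x y k) (sym (cong₂ _*_ (pow≡^ x k) (pow≡^ y k))))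

  pow-1 : ∀ k → pow 1# k ≡ 1#
  pow-1 k = trans (pow≡^ 1# k) (1^k≡1 k)

  pow-inv : ∀ k {x} (x≢0 : x ≢ 0#) → pow (inv x x≢0) k * pow x k ≡ 1#
  pow-inv k {x} x≢0 = trans (sym (pow-distrib-* k _ x)) (trans (cong (λ z → pow z k) (*-inverseˡ x≢0)) (pow-1 k))

  pow-nonzero : ∀ k {x} → x ≢ 0# → pow x k ≢ 0#
  pow-nonzero k {x} x≢0 = subst (_≢ 0#) (sym (pow≡^ x k)) (^-nonzero k x≢0)

  1+[q-1]≡q : suc (ℕ.pred q) ≡ q
  1+[q-1]≡q = ℕ.suc-pred q {{ℕ.>-nonZero (ℕ.<-trans ℕ.z<s 1<q)}}

  fr-0 : fr 0# ≡ 0#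
  fr-0 = subst (λ k → pow 0# k ≡ 0#) 1+[q-1]≡q (zeroˡ _)

  fr-1 : fr 1# ≡ 1#
  fr-1 = pow-1 q

  fr²-0 : fr (fr 0#) ≡ 0#
  fr²-0 = trans (cong fr fr-0) fr-0

  fr²-1 : fr (fr 1#) ≡ 1#
  fr²-1 = trans (cong fr fr-1) fr-1

  fr-* : ∀ x y → fr (x * y) ≡ fr x * fr y
  fr-* = pow-distrib-* q

  fr³≡id : ∀ x → fr (fr (fr x)) ≡ x
  fr³≡id x = begin
    fr (fr (fr x))               ≡⟨ cong fr (pow-pow x q q) ⟩
    pow (pow x (q ℕ.* q)) q      ≡⟨ pow-pow x (q ℕ.* q) q ⟩
    pow x (q ℕ.* q ℕ.* q)        ≡⟨ cong (pow x) (q*q*q≡q^3 q) ⟩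
    pow x (q ℕ.^ 3)              ≡⟨ pow≡^ x (q ℕ.^ 3) ⟩
    x ^ (q ℕ.^ 3)                ≡⟨ x^n≡x x ⟩
    x                            ∎
    where
    open ≡-Reasoning
    q*q*q≡q^3 : ∀ m → m ℕ.* m ℕ.* m ≡ m ℕ.* (m ℕ.* (m ℕ.* 1))
    q*q*q≡q^3 = solve-∀

  fr-injective : ∀ {x y} → fr x ≡ fr y → x ≡ y
  fr-injective {x} {y} frx≡fry = trans (sym (fr³≡id x)) (trans (cong (fr ∘ fr) frx≡fry) (fr³≡id y))

  fr-[-1] : fr (- 1#) ≡ - 1#
  fr-[-1] with x²≡1⇒x≡±1 (trans (sym (fr-* (- 1#) (- 1#))) (trans (cong fr -1*-1≡1) fr-1))
  ... | inj₁ fr[-1]≡1 = trans fr[-1]≡1 (sym (fr-injective (trans fr[-1]≡1 (sym fr-1))))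
  ... | inj₂ fr[-1]≡-1 = fr[-1]≡-1

  cofactor : Carrier → Carrier
  cofactor x = fr x * fr (fr x)

  N≡x*cofactor : ∀ x → N x ≡ x * cofactor x
  N≡x*cofactor x = begin
    pow x (q ℕ.^ 2 ℕ.+ q ℕ.+ 1)                ≡⟨ pow-+ x (q ℕ.^ 2 ℕ.+ q) 1 ⟩
    pow x (q ℕ.^ 2 ℕ.+ q) * pow x 1            ≡⟨ cong (_* pow x 1) (pow-+ x (q ℕ.^ 2) q) ⟩
    (pow x (q ℕ.^ 2) * fr x) * (x * 1#)        ≡⟨ cong (λ z → (z * fr x) * (x * 1#)) (sym fr²≡pow-q²) ⟩
    (fr (fr x) * fr x) * (x * 1#)              ≡⟨ solve 3 (λ a b c → (a :* b) :* (c :* :1) := c :* (b :* a)) refl (fr (fr x)) (fr x) x ⟩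
    x * (fr x * fr (fr x))                     ∎
    where
    open ≡-Reasoning
    fr²≡pow-q² : fr (fr x) ≡ pow x (q ℕ.^ 2)
    fr²≡pow-q² = trans (pow-pow x q q) (cong (λ k → pow x (q ℕ.* k)) (sym (ℕ.*-identityʳ q)))

  N-* : ∀ x y → N (x * y) ≡ N x * N y
  N-* = pow-distrib-* K

  N-1 : N 1# ≡ 1#
  N-1 = pow-1 K

  N-0 : N 0# ≡ 0#
  N-0 = trans (N≡x*cofactor 0#) (zeroˡ _)

  N-nonzero : ∀ {x} → x ≢ 0# → N x ≢ 0#
  N-nonzero = pow-nonzero K

  N≡0⇒x≡0 : ∀ {x} → N x ≡ 0# → x ≡ 0#
  N≡0⇒x≡0 {x} Nx≡0 with x ≟ 0#
  ... | yes x≡0 = x≡0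
  ... | no  x≢0 = ⊥-elim (N-nonzero x≢0 Nx≡0)

  N≡-1⇒x≢0 : ∀ {x} → N x ≡ - 1# → x ≢ 0#
  N≡-1⇒x≢0 Nx≡-1 x≡0 =
    1#≢0# (trans (sym (-‿involutive 1#)) (trans (cong -_ (trans (sym Nx≡-1) (trans (cong N x≡0) N-0))) -0#≈0#))

  N-inv : ∀ {x} (x≢0 : x ≢ 0#) → N (inv x x≢0) * N x ≡ 1#
  N-inv = pow-inv K

  N∘fr : ∀ x → N (fr x) ≡ N x
  N∘fr x = begin
    N (fr x)                        ≡⟨ N≡x*cofactor (fr x) ⟩
    fr x * (fr (fr x) * fr (fr (fr x))) ≡⟨ cong (λ z → fr x * (fr (fr x) * z)) (fr³≡id x) ⟩
    fr x * (fr (fr x) * x)          ≡⟨ solve 3 (λ a b c → a :* (b :* c) := c :* (a :* b)) refl (fr x) (fr (fr x)) x ⟩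
    x * (fr x * fr (fr x))          ≡⟨ sym (N≡x*cofactor x) ⟩
    N x                             ∎
    where open ≡-Reasoning

  N∈Fq : ∀ x → InFq (N x)
  N∈Fq x = trans (pow-comm x K q) (N∘fr x)

  N-[-1] : N (- 1#) ≡ - 1#
  N-[-1] = begin
    N (- 1#)                                ≡⟨ N≡x*cofactor (- 1#) ⟩
    - 1# * (fr (- 1#) * fr (fr (- 1#)))     ≡⟨ cong (λ z → - 1# * (z * fr z)) fr-[-1] ⟩
    - 1# * (- 1# * fr (- 1#))               ≡⟨ cong (λ z → - 1# * (- 1# * z)) fr-[-1] ⟩
    - 1# * (- 1# * - 1#)                    ≡⟨ solve 0 (:- :1 :* (:- :1 :* :- :1) := :- :1) refl ⟩
    - 1#                                    ∎
    where open ≡-Reasoning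

  N-neg : ∀ x → N (- x) ≡ - N x
  N-neg x = begin
    N (- x)          ≡⟨ cong N (solve 1 (λ x → :- x := :- :1 :* x) refl x) ⟩
    N (- 1# * x)     ≡⟨ N-* (- 1#) x ⟩
    N (- 1#) * N x   ≡⟨ cong (_* N x) N-[-1] ⟩
    - 1# * N x       ≡⟨ solve 1 (λ y → :- :1 :* y := :- y) refl (N x) ⟩
    - N x            ∎
    where open ≡-Reasoning

  N-of-Fq : ∀ {t} → InFq t → N t ≡ t * (t * t)
  N-of-Fq {t} t∈Fq = trans (N≡x*cofactor t) (cong (t *_) (cong₂ _*_ t∈Fq (trans (cong fr t∈Fq) t∈Fq)))

  cofactor-* : ∀ x y → cofactor (x * y) ≡ cofactor x * cofactor y
  cofactor-* x y = trans (cong₂ _*_ (fr-* x y) (trans (cong fr (fr-* x y)) (fr-* (fr x) (fr y))))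
    (solve 4 (λ a b c d → (a :* b) :* (c :* d) := (a :* c) :* (b :* d)) refl (fr x) (fr y) (fr (fr x)) (fr (fr y)))

  cofactor-0 : cofactor 0# ≡ 0#
  cofactor-0 = trans (cong (_* fr (fr 0#)) fr-0) (zeroˡ _)

  cofactor-1 : cofactor 1# ≡ 1#
  cofactor-1 = trans (cong₂ _*_ fr-1 (trans (cong fr fr-1) fr-1)) (*-identityˡ 1#)

  cofactor-nonzero : ∀ {x} → x ≢ 0# → cofactor x ≢ 0#
  cofactor-nonzero x≢0 = x*y≢0 (pow-nonzero q x≢0) (pow-nonzero q (pow-nonzero q x≢0))

  cofactor≡0⇒x≡0 : ∀ {x} → cofactor x ≡ 0# → x ≡ 0#
  cofactor≡0⇒x≡0 {x} cx≡0 = N≡0⇒x≡0 (trans (N≡x*cofactor x) (trans (cong (x *_) cx≡0) (zeroʳ x)))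

  N-cofactor : ∀ x → N (cofactor x) ≡ N x * N x
  N-cofactor x = trans (N-* (fr x) (fr (fr x))) (cong₂ _*_ (N∘fr x) (trans (N∘fr (fr x)) (N∘fr x)))

  1+[q-1]K≡q³ : suc (ℕ.pred q ℕ.* K) ≡ q ℕ.^ 3
  1+[q-1]K≡q³ = subst (λ m → suc (ℕ.pred m ℕ.* (m ℕ.^ 2 ℕ.+ m ℕ.+ 1)) ≡ m ℕ.^ 3) 1+[q-1]≡q (cube-identity (ℕ.pred q))

  module NormOne = PowerMap (ℕ.pred q) K 1+[q-1]K≡q³

  hilbert90 : ∀ {w} → N w ≡ 1# → ∃ λ x → x ≢ 0# × fr x ≡ x * w
  hilbert90 {w} Nw≡1 =
    let (x , x≢0 , x^[q-1]≡w) = NormOne.^-onto-rootsOfUnity (trans (sym (pow≡^ w K)) Nw≡1)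
    in x , x≢0 , (begin
      pow x q                    ≡⟨ cong (pow x) (sym 1+[q-1]≡q) ⟩
      x * pow x (ℕ.pred q)       ≡⟨ cong (x *_) (trans (pow≡^ x (ℕ.pred q)) x^[q-1]≡w) ⟩
      x * w                      ∎)
    where open ≡-Reasoning

module PlaneGeometry (q : ℕ) (F : FiniteField (q ℕ.^ 3)) where
  open FrobeniusNorm q F

  proper₁ : ∀ {x y z} → x ≢ 0# → Proper (x , y , z)
  proper₁ x≢0 refl = x≢0 refl

  proper₂ : ∀ {x y z} → y ≢ 0# → Proper (x , y , z)
  proper₂ y≢0 refl = y≢0 refl

  proper₃ : ∀ {x y z} → z ≢ 0# → Proper (x , y , z)
  proper₃ z≢0 refl = z≢0 refl

  improper : ∀ {x y z} → Proper (x , y , z) → x ≡ 0# → y ≡ 0# → z ≡ 0# → ⊥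
  improper p refl refl refl = p refl

  scale-components : ∀ {c x y z x′ y′ z′} → (x′ , y′ , z′) ≡ scale c (x , y , z) →
    x′ ≡ c * x × y′ ≡ c * y × z′ ≡ c * z
  scale-components refl = refl , refl , refl

  triple-cong : ∀ {x y z x′ y′ z′ : Carrier} → x ≡ x′ → y ≡ y′ → z ≡ z′ → (x , y , z) ≡ (x′ , y′ , z′)
  triple-cong refl refl refl = refl

  scale-scale : ∀ c d u → scale c (scale d u) ≡ scale (c * d) u
  scale-scale c d (x , y , z) = triple-cong (sym (*-assoc c d x)) (sym (*-assoc c d y)) (sym (*-assoc c d z))

  scale-1 : ∀ u → scale 1# u ≡ u
  scale-1 (x , y , z) = triple-cong (*-identityˡ x) (*-identityˡ y) (*-identityˡ z)

  ∼-refl : ∀ {u} → Proper u → u ∼ u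
  ∼-refl {u} pu = pu , pu , 1# , 1#≢0# , sym (scale-1 u)

  ∼-sym : ∀ {u v} → u ∼ v → v ∼ u
  ∼-sym {u} (pu , pv , c , c≢0 , refl) = pv , pu , inv c c≢0 , inv-nonzero c≢0 ,
    sym (trans (scale-scale _ c u) (trans (cong (λ k → scale k u) (*-inverseˡ c≢0)) (scale-1 u)))

  ∼-trans : ∀ {u v w} → u ∼ v → v ∼ w → u ∼ w
  ∼-trans {u} (pu , _ , c , c≢0 , refl) (_ , pw , d , d≢0 , refl) = pu , pw , d * c , x*y≢0 d≢0 c≢0 , scale-scale d c u

  Inc-scale : ∀ c P ℓ → Inc P ℓ → Inc (scale c P) ℓ
  Inc-scale k (x , y , z) (a , b , c) P∈ℓ = begin
    a * (k * x) + b * (k * y) + c * (k * z)  ≡⟨ solve 7 (λ k x y z a b c → a :* (k :* x) :+ b :* (k :* y) :+ c :* (k :* z)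
                                                   := k :* (a :* x :+ b :* y :+ c :* z)) refl k x y z a b c ⟩
    k * (a * x + b * y + c * z)              ≡⟨ cong (k *_) P∈ℓ ⟩
    k * 0#                                   ≡⟨ zeroʳ k ⟩
    0#                                       ∎
    where open ≡-Reasoning

  Inc-resp-∼ : ∀ {P P′} ℓ → P ∼ P′ → Inc P ℓ → Inc P′ ℓ
  Inc-resp-∼ {P} ℓ (_ , _ , c , _ , refl) = Inc-scale c P ℓ

  Inc-swap : ∀ P ℓ → Inc P ℓ → Inc ℓ P
  Inc-swap (x , y , z) (a , b , c) = trans
    (solve 6 (λ x y z a b c → x :* a :+ y :* b :+ z :* c := a :* x :+ b :* y :+ c :* z) refl x y z a b c)

  Inc-m_T : ∀ x y → Inc (x , y , 0#) m_T
  Inc-m_T x y = solve 2 (λ x y → :0 :* x :+ :0 :* y :+ :1 :* :0 := :0) refl x y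

  Inc-m_T⁻ : ∀ {x y z} → Inc (x , y , z) m_T → z ≡ 0#
  Inc-m_T⁻ {x} {y} {z} = trans
    (solve 3 (λ x y z → z := :0 :* x :+ :0 :* y :+ :1 :* z) refl x y z)

  Inc-T : ∀ a b → Inc T (a , b , 0#)
  Inc-T a b = solve 2 (λ a b → a :* :0 :+ b :* :0 :+ :0 :* :1 := :0) refl a b

  Inc-T⁻ : ∀ {a b c} → Inc T (a , b , c) → c ≡ 0#
  Inc-T⁻ {a} {b} {c} = trans
    (solve 3 (λ a b c → c := a :* :0 :+ b :* :0 :+ c :* :1) refl a b c)

  proportional⇒multiple : ∀ {x y u v} → Proper (x , y , 0#) → x * v ≡ y * u → ∃ λ k → u ≡ k * x × v ≡ k * y
  proportional⇒multiple {x} {y} {u} {v} pxy xv≡yu with x ≟ 0#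
  ... | no x≢0 = u * inv x x≢0 , sym (a*x⁻¹*x≡a x≢0) , *-cancelˡ x≢0 (begin
    x * v                        ≡⟨ xv≡yu ⟩
    y * u                        ≡⟨ cong (y *_) (sym (a*x⁻¹*x≡a x≢0)) ⟩
    y * ((u * inv x x≢0) * x)    ≡⟨ solve 3 (λ y k x → y :* (k :* x) := x :* (k :* y)) refl y (u * inv x x≢0) x ⟩
    x * ((u * inv x x≢0) * y)    ∎)
    where open ≡-Reasoning
  ... | yes refl = v * inv y y≢0 , u≡0 , sym (a*x⁻¹*x≡a y≢0)
    where
    y≢0 : y ≢ 0#
    y≢0 y≡0 = improper pxy refl y≡0 refl
    u≡0 : u ≡ (v * inv y y≢0) * 0#
    u≡0 with x*y≡0⇒x≡0⊎y≡0 (trans (sym xv≡yu) (zeroˡ v))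
    ... | inj₁ y≡0 = ⊥-elim (y≢0 y≡0)
    ... | inj₂ u≡0 = trans u≡0 (sym (zeroʳ _))

  proportional⇒∼ : ∀ {x y u v} → Proper (x , y , 0#) → Proper (u , v , 0#) → x * v ≡ y * u →
    (x , y , 0#) ∼ (u , v , 0#)
  proportional⇒∼ {x} {y} pxy puv xv≡yu =
    let (k , u≡kx , v≡ky) = proportional⇒multiple pxy xv≡yu
        k≢0 k≡0 = improper puv (trans u≡kx (trans (cong (_* x) k≡0) (zeroˡ x)))
                               (trans v≡ky (trans (cong (_* y) k≡0) (zeroˡ y))) refl
    in pxy , puv , k , k≢0 , triple-cong u≡kx v≡ky (sym (zeroʳ k))

  e1 : Triple
  e1 = (1# , 0# , 0#)

  pt : Carrier → Triple
  pt y = (y , 1# , 0#)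

  pt-injective : ∀ {y y′} → pt y ∼ pt y′ → y ≡ y′
  pt-injective {y} {y′} (_ , _ , c , _ , e) with scale-components e
  ... | y′≡cy , 1≡c1 , _ = sym (begin
    y′      ≡⟨ y′≡cy ⟩
    c * y   ≡⟨ cong (_* y) (trans (sym (*-identityʳ c)) (sym 1≡c1)) ⟩
    1# * y  ≡⟨ *-identityˡ y ⟩
    y       ∎)
    where open ≡-Reasoning

  e1≁pt : ∀ {y} → ¬ e1 ∼ pt y
  e1≁pt (_ , _ , c , _ , e) = 1#≢0# (trans (proj₁ (proj₂ (scale-components e))) (zeroʳ c))

  ∼e1 : ∀ {x} → x ≢ 0# → (x , 0# , 0#) ∼ e1
  ∼e1 {x} x≢0 = proportional⇒∼ (proper₁ x≢0) (proper₁ 1#≢0#) (trans (zeroʳ x) (sym (zeroˡ 1#)))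

  ∼pt : ∀ {x y} (y≢0 : y ≢ 0#) → (x , y , 0#) ∼ pt (x * inv y y≢0)
  ∼pt {x} {y} y≢0 = proportional⇒∼ (proper₂ y≢0) (proper₂ 1#≢0#)
    (trans (*-identityʳ x) (sym (trans (*-comm y _) (a*x⁻¹*x≡a y≢0))))

  point-of-m_T : ∀ {Q} → Proper Q → Inc Q m_T → Q ∼ e1 ⊎ ∃ λ t → Q ∼ pt t
  point-of-m_T {x , y , z} pQ Q∈m_T with Inc-m_T⁻ Q∈m_T | y ≟ 0#
  ... | refl | yes refl = inj₁ (∼e1 (λ x≡0 → improper pQ x≡0 refl refl))
  ... | refl | no  y≢0  = inj₂ (_ , ∼pt y≢0)

  ∼T : ∀ {u v w} → u ≡ 0# → v ≡ 0# → w ≢ 0# → (u , v , w) ∼ T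
  ∼T refl refl w≢0 = proper₃ w≢0 , proper₃ 1#≢0# , inv _ w≢0 , inv-nonzero w≢0 ,
    triple-cong (sym (zeroʳ _)) (sym (zeroʳ _)) (sym (*-inverseˡ w≢0))

  proj : Triple → Triple
  proj (u , v , w) = (u , v , 0#)

  Pr-intro : ∀ {B : PointSet} {P Q} → B P → Q ∼ proj P → Pr B Q
  Pr-intro {P = u , v , w} P∈B Q∼πP@(pQ , pπP , _) =
    _ , P∈B , P≁T , pQ , Inc-resp-∼ m_T (∼-sym Q∼πP) (Inc-m_T u v) ,
    (v , - u , 0#) , pℓ , Inc-T v (- u) , P∈ℓ , Inc-resp-∼ (v , - u , 0#) (∼-sym Q∼πP) πP∈ℓ
    where
    P≁T : ¬ (u , v , w) ∼ T
    P≁T (_ , _ , c , c≢0 , T≡cP) with scale-components T≡cP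
    ... | 0≡cu , 0≡cv , _ = improper pπP (x≢0∧x*y≡0⇒y≡0 c≢0 (sym 0≡cu)) (x≢0∧x*y≡0⇒y≡0 c≢0 (sym 0≡cv)) refl
    pℓ : Proper (v , - u , 0#)
    pℓ ℓ≡0 = improper pπP (trans (sym (-‿involutive u)) (trans (cong -_ (cong (proj₁ ∘ proj₂) ℓ≡0)) -0#≈0#))
                           (cong proj₁ ℓ≡0) refl
    P∈ℓ : Inc (u , v , w) (v , - u , 0#)
    P∈ℓ = solve 3 (λ u v w → v :* u :+ (:- u) :* v :+ :0 :* w := :0) refl u v w
    πP∈ℓ : Inc (u , v , 0#) (v , - u , 0#)
    πP∈ℓ = solve 2 (λ u v → v :* u :+ (:- u) :* v :+ :0 :* :0 := :0) refl u v

  Pr-resp-∼ : ∀ {B : PointSet} {Q Q′} → Q ∼ Q′ → Pr B Q → Pr B Q′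
  Pr-resp-∼ Q∼Q′@(_ , pQ′ , _) (P , P∈B , P≁T , _ , Q∈m_T , ℓ , pℓ , T∈ℓ , P∈ℓ , Q∈ℓ) =
    P , P∈B , P≁T , pQ′ , Inc-resp-∼ m_T Q∼Q′ Q∈m_T , ℓ , pℓ , T∈ℓ , P∈ℓ , Inc-resp-∼ ℓ Q∼Q′ Q∈ℓ

  HasSize-from-list : ∀ {B : PointSet} (L : List Triple) → All B L → AllPairs (λ P P′ → ¬ P ∼ P′) L →
    (∀ {Q} → B Q → ∃ λ P → P ∈ L × Q ∼ P) → HasSize B (length L)
  HasSize-from-list L L⊆B distinct covers =
    lookup L , (λ i → All.lookup L⊆B (∈-lookup i)) , lookup-injective L distinct , λ Q Q∈B →
      let (P , P∈L , Q∼P) = covers Q∈B in index P∈L , subst (Q ∼_) (lookup-index P∈L) Q∼P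
    where
    lookup-injective : ∀ L → AllPairs (λ P P′ → ¬ P ∼ P′) L → ∀ i j → lookup L i ∼ lookup L j → i ≡ j
    lookup-injective (P ∷ L) (P≁ ∷ _) Fin.zero    Fin.zero    _ = refl
    lookup-injective (P ∷ L) (P≁ ∷ _) Fin.zero    (Fin.suc j) P∼ = ⊥-elim (All.lookup P≁ (∈-lookup j) P∼)
    lookup-injective (P ∷ L) (P≁ ∷ _) (Fin.suc i) Fin.zero    ∼P = ⊥-elim (All.lookup P≁ (∈-lookup i) (∼-sym ∼P))
    lookup-injective (P ∷ L) (_ ∷ d)  (Fin.suc i) (Fin.suc j) ∼  = cong Fin.suc (lookup-injective L d i j ∼)

  on-line-through-T⇒proportional : ∀ {a b x y u v w} → Proper (a , b , 0#) →
    Inc (x , y , 0#) (a , b , 0#) → Inc (u , v , w) (a , b , 0#) → x * v ≡ y * u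
  on-line-through-T⇒proportional {a} {b} {x} {y} {u} {v} {w} pℓ Q∈ℓ P∈ℓ with a ≟ 0# | b ≟ 0#
  ... | yes refl | yes refl = ⊥-elim (pℓ refl)
  ... | no a≢0 | _ = x-y≡0⇒x≡y (x≢0∧x*y≡0⇒y≡0 a≢0 (begin
    a * (x * v + - (y * u))                              ≡⟨ solve 7 (λ a b x y u v w → a :* (x :* v :- y :* u)
                                                              := v :* (a :* x :+ b :* y :+ :0 :* :0)
                                                                 :- y :* (a :* u :+ b :* v :+ :0 :* w)) refl a b x y u v w ⟩
    v * Σx + - (y * Σu)                                  ≡⟨ cong₂ (λ s t → v * s + - (y * t)) Q∈ℓ P∈ℓ ⟩
    v * 0# + - (y * 0#)                                  ≡⟨ solve 2 (λ v y → v :* :0 :- y :* :0 := :0) refl v y ⟩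
    0#                                                   ∎))
    where
    open ≡-Reasoning
    Σx = a * x + b * y + 0# * 0#
    Σu = a * u + b * v + 0# * w
  ... | _ | no b≢0 = x-y≡0⇒x≡y (x≢0∧x*y≡0⇒y≡0 b≢0 (begin
    b * (x * v + - (y * u))                              ≡⟨ solve 7 (λ a b x y u v w → b :* (x :* v :- y :* u)
                                                              := x :* (a :* u :+ b :* v :+ :0 :* w)
                                                                 :- u :* (a :* x :+ b :* y :+ :0 :* :0)) refl a b x y u v w ⟩
    x * Σu + - (u * Σx)                                  ≡⟨ cong₂ (λ s t → x * s + - (u * t)) P∈ℓ Q∈ℓ ⟩
    x * 0# + - (u * 0#)                                  ≡⟨ solve 2 (λ x u → x :* :0 :- u :* :0 := :0) refl x u ⟩
    0#                                                   ∎))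
    where
    open ≡-Reasoning
    Σx = a * x + b * y + 0# * 0#
    Σu = a * u + b * v + 0# * w

  Pr-elim : ∀ {B : PointSet} {Q} → (∀ {P} → B P → Proper P) → Pr B Q → ∃ λ P → B P × Q ∼ proj P
  Pr-elim {Q = x , y , z} B-proper ((u , v , w) , P∈B , P≁T , pQ , Q∈m_T , (a , b , c) , pℓ , T∈ℓ , P∈ℓ , Q∈ℓ)
    with Inc-m_T⁻ Q∈m_T | Inc-T⁻ T∈ℓ
  ... | refl | refl = _ , P∈B , proportional⇒∼ pQ pπP (on-line-through-T⇒proportional pℓ Q∈ℓ P∈ℓ)
    where
    pπP : Proper (u , v , 0#)
    pπP πP≡0 = P≁T (∼T u≡0 v≡0 (improper (B-proper P∈B) u≡0 v≡0))
      where
      u≡0 = cong proj₁ πP≡0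
      v≡0 = cong (proj₁ ∘ proj₂) πP≡0

  det : Triple → Triple → Triple → Carrier
  det (a₁ , a₂ , a₃) (b₁ , b₂ , b₃) (c₁ , c₂ , c₃) =
    a₁ * (b₂ * c₃ + - (b₃ * c₂)) + a₂ * (b₃ * c₁ + - (b₁ * c₃)) + a₃ * (b₁ * c₂ + - (b₂ * c₁))

  -- Cramer's rule: each coordinate of det · P is a combination of the incidences lᵢ · P.
  det-common-point : ∀ l₁ l₂ l₃ {P} → Proper P → Inc P l₁ → Inc P l₂ → Inc P l₃ → det l₁ l₂ l₃ ≡ 0#
  det-common-point (a₁ , a₂ , a₃) (b₁ , b₂ , b₃) (c₁ , c₂ , c₃) {x , y , z} pP P∈l₁ P∈l₂ P∈l₃
    with det (a₁ , a₂ , a₃) (b₁ , b₂ , b₃) (c₁ , c₂ , c₃) ≟ 0#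
  ... | yes d≡0 = d≡0
  ... | no  d≢0 = ⊥-elim (improper pP (vanishes cramer-x) (vanishes cramer-y) (vanishes cramer-z))
    where
    D = det (a₁ , a₂ , a₃) (b₁ , b₂ , b₃) (c₁ , c₂ , c₃)
    ι₁ = a₁ * x + a₂ * y + a₃ * z
    ι₂ = b₁ * x + b₂ * y + b₃ * z
    ι₃ = c₁ * x + c₂ * y + c₃ * z
    vanishes : ∀ {t p₁ p₂ p₃} → D * t ≡ p₁ * ι₁ + p₂ * ι₂ + p₃ * ι₃ → t ≡ 0#
    vanishes {t} {p₁} {p₂} {p₃} Dt≡ = x≢0∧x*y≡0⇒y≡0 d≢0 (begin
      D * t                                    ≡⟨ Dt≡ ⟩
      p₁ * ι₁ + p₂ * ι₂ + p₃ * ι₃              ≡⟨ cong₂ _+_ (cong₂ _+_ (cong (p₁ *_) P∈l₁) (cong (p₂ *_) P∈l₂)) (cong (p₃ *_) P∈l₃) ⟩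
      p₁ * 0# + p₂ * 0# + p₃ * 0#              ≡⟨ solve 3 (λ p₁ p₂ p₃ → p₁ :* :0 :+ p₂ :* :0 :+ p₃ :* :0 := :0) refl p₁ p₂ p₃ ⟩
      0#                                       ∎)
      where open ≡-Reasoning
    cramer-x : D * x ≡ (b₂ * c₃ + - (b₃ * c₂)) * ι₁ + (c₂ * a₃ + - (c₃ * a₂)) * ι₂ + (a₂ * b₃ + - (a₃ * b₂)) * ι₃
    cramer-x = solve 12 (λ a₁ a₂ a₃ b₁ b₂ b₃ c₁ c₂ c₃ x y z →
      (a₁ :* (b₂ :* c₃ :- b₃ :* c₂) :+ a₂ :* (b₃ :* c₁ :- b₁ :* c₃) :+ a₃ :* (b₁ :* c₂ :- b₂ :* c₁)) :* x :=
      (b₂ :* c₃ :- b₃ :* c₂) :* (a₁ :* x :+ a₂ :* y :+ a₃ :* z) :+ (c₂ :* a₃ :- c₃ :* a₂) :* (b₁ :* x :+ b₂ :* y :+ b₃ :* z)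
        :+ (a₂ :* b₃ :- a₃ :* b₂) :* (c₁ :* x :+ c₂ :* y :+ c₃ :* z)) refl a₁ a₂ a₃ b₁ b₂ b₃ c₁ c₂ c₃ x y z
    cramer-y : D * y ≡ (b₃ * c₁ + - (b₁ * c₃)) * ι₁ + (c₃ * a₁ + - (c₁ * a₃)) * ι₂ + (a₃ * b₁ + - (a₁ * b₃)) * ι₃
    cramer-y = solve 12 (λ a₁ a₂ a₃ b₁ b₂ b₃ c₁ c₂ c₃ x y z →
      (a₁ :* (b₂ :* c₃ :- b₃ :* c₂) :+ a₂ :* (b₃ :* c₁ :- b₁ :* c₃) :+ a₃ :* (b₁ :* c₂ :- b₂ :* c₁)) :* y :=
      (b₃ :* c₁ :- b₁ :* c₃) :* (a₁ :* x :+ a₂ :* y :+ a₃ :* z) :+ (c₃ :* a₁ :- c₁ :* a₃) :* (b₁ :* x :+ b₂ :* y :+ b₃ :* z)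
        :+ (a₃ :* b₁ :- a₁ :* b₃) :* (c₁ :* x :+ c₂ :* y :+ c₃ :* z)) refl a₁ a₂ a₃ b₁ b₂ b₃ c₁ c₂ c₃ x y z
    cramer-z : D * z ≡ (b₁ * c₂ + - (b₂ * c₁)) * ι₁ + (c₁ * a₂ + - (c₂ * a₁)) * ι₂ + (a₁ * b₂ + - (a₂ * b₁)) * ι₃
    cramer-z = solve 12 (λ a₁ a₂ a₃ b₁ b₂ b₃ c₁ c₂ c₃ x y z →
      (a₁ :* (b₂ :* c₃ :- b₃ :* c₂) :+ a₂ :* (b₃ :* c₁ :- b₁ :* c₃) :+ a₃ :* (b₁ :* c₂ :- b₂ :* c₁)) :* z :=
      (b₁ :* c₂ :- b₂ :* c₁) :* (a₁ :* x :+ a₂ :* y :+ a₃ :* z) :+ (c₁ :* a₂ :- c₂ :* a₁) :* (b₁ :* x :+ b₂ :* y :+ b₃ :* z)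
        :+ (a₁ :* b₂ :- a₂ :* b₁) :* (c₁ :* x :+ c₂ :* y :+ c₃ :* z)) refl a₁ a₂ a₃ b₁ b₂ b₃ c₁ c₂ c₃ x y z

  Concurrent⇒det≡0 : ∀ l₁ l₂ l₃ → Concurrent l₁ l₂ l₃ → det l₁ l₂ l₃ ≡ 0#
  Concurrent⇒det≡0 l₁ l₂ l₃ (P , pP , P∈l₁ , P∈l₂ , P∈l₃) = det-common-point l₁ l₂ l₃ pP P∈l₁ P∈l₂ P∈l₃

  Collinear⇒det≡0 : ∀ P₁ P₂ P₃ → Collinear P₁ P₂ P₃ → det P₁ P₂ P₃ ≡ 0#
  Collinear⇒det≡0 P₁ P₂ P₃ (ℓ , pℓ , P₁∈ℓ , P₂∈ℓ , P₃∈ℓ) =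
    det-common-point P₁ P₂ P₃ pℓ (Inc-swap P₁ ℓ P₁∈ℓ) (Inc-swap P₂ ℓ P₂∈ℓ) (Inc-swap P₃ ℓ P₃∈ℓ)

  det-orbit : ∀ a b → det (a , b , 0#) (φ (a , b , 0#)) (φ² (a , b , 0#)) ≡ N a + N b
  det-orbit a b rewrite fr²-0 | fr-0 = begin
    a * (fr a * fr (fr a) + - (fr b * 0#)) + b * (fr b * fr (fr b) + - (0# * fr (fr a))) + 0# * (0# * 0# + - (fr a * fr (fr b)))
        ≡⟨ solve 6 (λ a b A₁ A₂ B₁ B₂ →
             a :* (A₁ :* A₂ :- B₁ :* :0) :+ b :* (B₁ :* B₂ :- :0 :* A₂)
               :+ :0 :* (:0 :* :0 :- A₁ :* B₂)
             := a :* (A₁ :* A₂) :+ b :* (B₁ :* B₂)) refl a b (fr a) (fr (fr a)) (fr b) (fr (fr b)) ⟩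
    a * cofactor a + b * cofactor b
        ≡⟨ sym (cong₂ _+_ (N≡x*cofactor a) (N≡x*cofactor b)) ⟩
    N a + N b ∎
    where open ≡-Reasoning

module FigBlock (q : ℕ) (F : FiniteField (q ℕ.^ 3)) where
  open FrobeniusNorm q F
  open PlaneGeometry q F

  NormIsFqSquare : Carrier → Set
  NormIsFqSquare θ = Σ Carrier λ s → InFq s × s ≢ 0# × s * s ≡ N θ

  Admissible : Carrier → Set
  Admissible y = y ≡ 0# ⊎ N y ≡ - 1# ⊎ NormIsFqSquare y

  Fig-proper : ∀ {P} → Fig_T P → Proper P
  Fig-proper (inj₁ ((pP , _) , _))            = pP
  Fig-proper (inj₂ (_ , _ , _ , (pP , _)))     = pP

  ℰ-point : ∀ {y} → N y ≡ - 1# → ℰ_T (pt y)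
  ℰ-point {y} Ny≡-1 = (proper₂ 1#≢0# , φP≁P , ℓ , proper₁ 1#≢0# , P∈ℓ , φP∈ℓ , φ²P∈ℓ) , Inc-m_T y 1#
    where
    -- the line through pt y and φ (pt y) = (0, y^q, 1); it contains φ² (pt y) = (1, 0, y^{q²})
    -- exactly when N y = −1
    ℓ : Triple
    ℓ = (1# , - y , y * fr y)
    φP≁P : ¬ φ (pt y) ∼ pt y
    φP≁P (_ , _ , k , k≢0 , e) =
      k≢0 (trans (sym (*-identityʳ k)) (trans (cong (k *_) (sym fr-1)) (sym (proj₂ (proj₂ (scale-components e))))))
    P∈ℓ : Inc (pt y) ℓ
    P∈ℓ = solve 2 (λ y f → :1 :* y :+ (:- y) :* :1 :+ (y :* f) :* :0 := :0) refl y (fr y)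
    φP∈ℓ : Inc (φ (pt y)) ℓ
    φP∈ℓ rewrite fr-0 | fr-1 =
      solve 2 (λ y f → :1 :* :0 :+ (:- y) :* f :+ (y :* f) :* :1 := :0) refl y (fr y)
    φ²P∈ℓ : Inc (φ² (pt y)) ℓ
    φ²P∈ℓ rewrite fr²-1 | fr²-0 = begin
      1# * 1# + - y * 0# + y * fr y * fr (fr y)  ≡⟨ solve 3 (λ y f g → :1 :* :1 :+ (:- y) :* :0 :+ (y :* f) :* g
                                                        := :1 :+ y :* (f :* g)) refl y (fr y) (fr (fr y)) ⟩
      1# + y * cofactor y                        ≡⟨ cong (1# +_) (trans (sym (N≡x*cofactor y)) Ny≡-1) ⟩
      1# + - 1#                                  ≡⟨ -‿inverseʳ 1# ⟩
      0#                                         ∎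
      where open ≡-Reasoning

  projected-μ : ∀ {a b} → a ≢ 0# ⊎ b ≢ 0# → N a + N b ≢ 0# → Pr Fig_T (cofactor a , cofactor b , 0#)
  projected-μ {a} {b} a≢0⊎b≢0 Na+Nb≢0 =
    Pr-intro (inj₂ (ℓ , (pℓ , ¬concurrent) , Inc-T a b , pP , P∈φℓ , P∈φ²ℓ)) (∼-refl pP)
    where
    ℓ = (a , b , 0#)
    P = (cofactor a , cofactor b , - (fr a * fr (fr b)))
    pℓ : Proper ℓ
    pℓ = [ proper₁ , proper₂ ]′ a≢0⊎b≢0
    pP : ∀ {z} → Proper (cofactor a , cofactor b , z)
    pP = [ proper₁ ∘ cofactor-nonzero , proper₂ ∘ cofactor-nonzero ]′ a≢0⊎b≢0
    ¬concurrent : ¬ Concurrent ℓ (φ ℓ) (φ² ℓ)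
    ¬concurrent c = Na+Nb≢0 (trans (sym (det-orbit a b)) (Concurrent⇒det≡0 ℓ (φ ℓ) (φ² ℓ) c))
    P∈φℓ : Inc P (φ ℓ)
    P∈φℓ rewrite fr-0 = solve 4 (λ fa fb ffa ffb → :0 :* (fa :* ffa) :+ fa :* (fb :* ffb) :+ fb :* (:- (fa :* ffb)) := :0)
                          refl (fr a) (fr b) (fr (fr a)) (fr (fr b))
    P∈φ²ℓ : Inc P (φ² ℓ)
    P∈φ²ℓ rewrite fr²-0 = solve 4 (λ fa fb ffa ffb → ffb :* (fa :* ffa) :+ :0 :* (fb :* ffb) :+ ffa :* (:- (fa :* ffb)) := :0)
                          refl (fr a) (fr b) (fr (fr a)) (fr (fr b))

  Pr-Fig-e1 : Pr Fig_T e1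
  Pr-Fig-e1 = subst (Pr Fig_T) (triple-cong cofactor-1 cofactor-0 refl)
    (projected-μ (inj₁ 1#≢0#) (λ N1+N0≡0 → 1#≢0# (trans (sym (trans (cong₂ _+_ N-1 N-0) (+-identityʳ 1#))) N1+N0≡0)))

  NormIsFqSquare⇒≢0 : ∀ {y} → NormIsFqSquare y → y ≢ 0#
  NormIsFqSquare⇒≢0 {y} (s , _ , s≢0 , s²≡Ny) y≡0 = x*y≢0 s≢0 s≢0 (trans s²≡Ny (trans (cong N y≡0) N-0))

  square-root-≢-1 : ∀ {y} → NormIsFqSquare y → N y ≢ - 1# → ∃ λ t → InFq t × t * t ≡ N y × t ≢ - 1#
  square-root-≢-1 {y} (s , s∈Fq , _ , s²≡Ny) Ny≢-1 with s ≟ - 1#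
  ... | no  s≢-1 = s , s∈Fq , s²≡Ny , s≢-1
  ... | yes refl = 1# , fr-1 , 1²≡Ny , λ 1≡-1 → Ny≢-1 (trans (sym 1²≡Ny) (trans (*-identityˡ 1#) 1≡-1))
    where
    1²≡Ny : 1# * 1# ≡ N y
    1²≡Ny = trans (*-identityˡ 1#) (trans (sym -1*-1≡1) s²≡Ny)

  -- ℓ = [t/y, 1, 0] has N (t/y) = t, so it is of Type III exactly when t ≢ −1.
  Pr-Fig-pt-from-root : ∀ {y t} (y≢0 : y ≢ 0#) → InFq t → t * t ≡ N y → t ≢ - 1# → Pr Fig_T (pt y)
  Pr-Fig-pt-from-root {y} {t} y≢0 t∈Fq t²≡Ny t≢-1 =
    subst (Pr Fig_T) (triple-cong cofactor-c≡y cofactor-1 refl) (projected-μ (inj₂ 1#≢0#) Nc+N1≢0)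
    where
    open ≡-Reasoning
    c = t * inv y y≢0
    t≢0 : t ≢ 0#
    t≢0 t≡0 = y≢0 (N≡0⇒x≡0 (trans (sym t²≡Ny) (trans (cong (_* t) t≡0) (zeroˡ t))))
    Nc≡t : N c ≡ t
    Nc≡t = *-cancelˡ (x*y≢0 t≢0 t≢0) (begin
      (t * t) * N c                          ≡⟨ cong₂ _*_ t²≡Ny (N-* t _) ⟩
      N y * (N t * N (inv y y≢0))            ≡⟨ solve 3 (λ a b c → a :* (b :* c) := b :* (c :* a)) refl (N y) (N t) _ ⟩
      N t * (N (inv y y≢0) * N y)            ≡⟨ cong₂ _*_ (N-of-Fq t∈Fq) (N-inv y≢0) ⟩
      (t * (t * t)) * 1#                     ≡⟨ solve 1 (λ t → (t :* (t :* t)) :* :1 := (t :* t) :* t) refl t ⟩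
      (t * t) * t                            ∎)
    cofactor-c≡y : cofactor c ≡ y
    cofactor-c≡y = *-cancelˡ (inv-nonzero y≢0) (*-cancelˡ t≢0 (begin
      t * (inv y y≢0 * cofactor c)  ≡⟨ sym (*-assoc t _ _) ⟩
      c * cofactor c                ≡⟨ sym (N≡x*cofactor c) ⟩
      N c                           ≡⟨ Nc≡t ⟩
      t                             ≡⟨ sym (*-identityʳ t) ⟩
      t * 1#                        ≡⟨ cong (t *_) (sym (*-inverseˡ y≢0)) ⟩
      t * (inv y y≢0 * y)           ∎))
    Nc+N1≢0 : N c + N 1# ≢ 0#
    Nc+N1≢0 Nc+N1≡0 = t≢-1 (x+y≡0⇒x≡-y (trans (cong₂ _+_ (sym Nc≡t) (sym N-1)) Nc+N1≡0))

  Pr-Fig-pt : ∀ {y} → Admissible y → Pr Fig_T (pt y)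
  Pr-Fig-pt (inj₁ refl) = subst (Pr Fig_T) (triple-cong cofactor-0 cofactor-1 refl)
    (projected-μ (inj₂ 1#≢0#) (λ N0+N1≡0 → 1#≢0# (trans (sym (trans (cong₂ _+_ N-0 N-1) (+-identityˡ 1#))) N0+N1≡0)))
  Pr-Fig-pt (inj₂ (inj₁ Ny≡-1)) = Pr-intro (inj₁ (ℰ-point Ny≡-1)) (∼-refl (proper₂ 1#≢0#))
  Pr-Fig-pt {y} (inj₂ (inj₂ square)) with N y ≟ - 1#
  ... | yes Ny≡-1 = Pr-intro (inj₁ (ℰ-point Ny≡-1)) (∼-refl (proper₂ 1#≢0#))
  ... | no  Ny≢-1 = let (t , t∈Fq , t²≡Ny , t≢-1) = square-root-≢-1 square Ny≢-1
                    in Pr-Fig-pt-from-root (NormIsFqSquare⇒≢0 square) t∈Fq t²≡Ny t≢-1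

  admissible-cofactor : ∀ z → Admissible (cofactor z)
  admissible-cofactor z with z ≟ 0#
  ... | yes refl = inj₁ cofactor-0
  ... | no  z≢0  = inj₂ (inj₂ (N z , N∈Fq z , N-nonzero z≢0 , sym (N-cofactor z)))

  cofactor-ratio : ∀ {a b} (b≢0 : b ≢ 0#) → (cofactor a , cofactor b , 0#) ∼ pt (cofactor (a * inv b b≢0))
  cofactor-ratio {a} {b} b≢0 = proportional⇒∼ (proper₂ (cofactor-nonzero b≢0)) (proper₂ 1#≢0#) (begin
    cofactor a * 1#                           ≡⟨ *-identityʳ _ ⟩
    cofactor a                                ≡⟨ cong cofactor (sym (a*x⁻¹*x≡a b≢0)) ⟩
    cofactor ((a * inv b b≢0) * b)            ≡⟨ cofactor-* _ b ⟩
    cofactor (a * inv b b≢0) * cofactor b     ≡⟨ *-comm _ _ ⟩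
    cofactor b * cofactor (a * inv b b≢0)     ∎)
    where open ≡-Reasoning

  μ-proportional : ∀ {a b u v w} → Inc (u , v , w) (φ (a , b , 0#)) → Inc (u , v , w) (φ² (a , b , 0#)) →
    u * cofactor b ≡ v * cofactor a
  μ-proportional {a} {b} {u} {v} {w} P∈φℓ P∈φ²ℓ rewrite fr²-0 | fr-0 = x-y≡0⇒x≡y (begin
    u * (fb * ffb) + - (v * (fa * ffa))
      ≡⟨ solve 7 (λ u v w fa fb ffa ffb → u :* (fb :* ffb) :- v :* (fa :* ffa)
                   := fb :* (ffb :* u :+ :0 :* v :+ ffa :* w) :- ffa :* (:0 :* u :+ fa :* v :+ fb :* w))
           refl u v w fa fb ffa ffb ⟩
    fb * (ffb * u + 0# * v + ffa * w) + - (ffa * (0# * u + fa * v + fb * w))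
      ≡⟨ cong₂ (λ s t → fb * s + - (ffa * t)) P∈φ²ℓ P∈φℓ ⟩
    fb * 0# + - (ffa * 0#)
      ≡⟨ solve 2 (λ x y → x :* :0 :- y :* :0 := :0) refl fb ffa ⟩
    0# ∎)
    where
    open ≡-Reasoning
    fa = fr a
    fb = fr b
    ffa = fr (fr a)
    ffb = fr (fr b)

  ℰ-classify : ∀ {P Q} → ℰ_T P → Q ∼ proj P → ∃ λ y → Q ∼ pt y × N y ≡ - 1#
  ℰ-classify {u , v , w} ((pP , _ , collinear) , P∈m_T) Q∼πP with Inc-m_T⁻ P∈m_T
  ... | refl = u * inv v v≢0 , ∼-trans Q∼πP (∼pt v≢0) , (begin
    N (u * inv v v≢0)            ≡⟨ N-* u _ ⟩
    N u * N (inv v v≢0)          ≡⟨ cong (_* N (inv v v≢0)) (x+y≡0⇒x≡-y Nu+Nv≡0) ⟩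
    - N v * N (inv v v≢0)        ≡⟨ solve 2 (λ a b → (:- a) :* b := :- (b :* a)) refl (N v) _ ⟩
    - (N (inv v v≢0) * N v)      ≡⟨ cong -_ (N-inv v≢0) ⟩
    - 1#                         ∎)
    where
    open ≡-Reasoning
    Nu+Nv≡0 : N u + N v ≡ 0#
    Nu+Nv≡0 = trans (sym (det-orbit u v)) (Collinear⇒det≡0 (u , v , 0#) _ _ collinear)
    v≢0 : v ≢ 0#
    v≢0 v≡0 = improper pP (N≡0⇒x≡0 Nu≡0) v≡0 refl
      where
      Nu≡0 : N u ≡ 0#
      Nu≡0 = trans (x+y≡0⇒x≡-y Nu+Nv≡0) (trans (cong (λ z → - N z) v≡0) (trans (cong -_ N-0) -0#≈0#))

  ℱ-classify : ∀ {P Q} → ℱ_T P → Q ∼ proj P → Q ∼ e1 ⊎ ∃ λ y → Q ∼ pt y × Admissible y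
  ℱ-classify {u , v , w} {Q} ((a , b , c) , (pℓ , _) , T∈ℓ , _ , P∈φℓ , P∈φ²ℓ) Q∼πP@(_ , pπP , _) with Inc-T⁻ T∈ℓ
  ... | refl = Sum.map (∼-trans Q∼AB) (λ (y , AB∼pt , adm) → y , ∼-trans Q∼AB AB∼pt , adm) AB-classified
    where
    pAB : Proper (cofactor a , cofactor b , 0#)
    pAB AB≡0 = improper pℓ (cofactor≡0⇒x≡0 (cong proj₁ AB≡0)) (cofactor≡0⇒x≡0 (cong (proj₁ ∘ proj₂) AB≡0)) refl
    Q∼AB : Q ∼ (cofactor a , cofactor b , 0#)
    Q∼AB = ∼-trans Q∼πP (proportional⇒∼ pπP pAB (μ-proportional P∈φℓ P∈φ²ℓ))
    AB-classified : (cofactor a , cofactor b , 0#) ∼ e1 ⊎ ∃ λ y → (cofactor a , cofactor b , 0#) ∼ pt y × Admissible y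
    AB-classified with b ≟ 0#
    ... | yes b≡0 = inj₁ (subst (λ B → (cofactor a , B , 0#) ∼ e1) (sym B≡0)
                                (∼e1 λ A≡0 → pAB (triple-cong A≡0 B≡0 refl)))
      where
      B≡0 : cofactor b ≡ 0#
      B≡0 = trans (cong cofactor b≡0) cofactor-0
    ... | no  b≢0  = inj₂ (_ , cofactor-ratio b≢0 , admissible-cofactor _)

  Pr-Fig-classify : ∀ {Q} → Pr Fig_T Q → Q ∼ e1 ⊎ ∃ λ y → Q ∼ pt y × Admissible y
  Pr-Fig-classify Q∈ with Pr-elim Fig-proper Q∈
  ... | _ , inj₁ P∈ℰ , Q∼πP = let (y , Q∼pt , Ny≡-1) = ℰ-classify P∈ℰ Q∼πP
                              in inj₂ (y , Q∼pt , inj₂ (inj₁ Ny≡-1))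
  ... | _ , inj₂ P∈ℱ , Q∼πP = ℱ-classify P∈ℱ Q∼πP

  Pr-Fig-on-m_T : ∀ {Q} → Proper Q → Inc Q m_T → (∀ {t} → Q ∼ pt t → Admissible t) → Pr Fig_T Q
  Pr-Fig-on-m_T pQ Q∈m_T admissible with point-of-m_T pQ Q∈m_T
  ... | inj₁ Q∼e1       = Pr-resp-∼ (∼-sym Q∼e1) Pr-Fig-e1
  ... | inj₂ (t , Q∼pt) = Pr-resp-∼ (∼-sym Q∼pt) (Pr-Fig-pt (admissible Q∼pt))

  φT≡e1 : φ T ≡ e1
  φT≡e1 = triple-cong fr-1 fr-0 fr-0

  φ²T≡pt0 : φ² T ≡ pt 0#
  φ²T≡pt0 = triple-cong fr²-0 fr²-1 fr²-0

  𝒮-pt⇒N≡ : ∀ {θ y} → 𝒮 θ (pt y) → N y ≡ N θ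
  𝒮-pt⇒N≡ {θ} {y} (x , x≢0 , (_ , _ , k , _ , e)) with scale-components e
  ... | xθ≡ky , frx≡k1 , _ = *-cancelˡ (N-nonzero x≢0) (begin
    N x * N y          ≡⟨ cong (_* N y) (sym (N∘fr x)) ⟩
    N (fr x) * N y     ≡⟨ sym (N-* (fr x) y) ⟩
    N (fr x * y)       ≡⟨ cong (λ z → N (z * y)) (trans frx≡k1 (*-identityʳ k)) ⟩
    N (k * y)          ≡⟨ cong N (sym xθ≡ky) ⟩
    N (x * θ)          ≡⟨ N-* x θ ⟩
    N x * N θ          ∎)
    where open ≡-Reasoning

  𝒮-self : ∀ θ → 𝒮 θ (pt θ)
  𝒮-self θ = 1# , 1#≢0# , subst (pt θ ∼_) (sym (triple-cong (*-identityˡ θ) fr-1 refl)) (∼-refl (proper₂ 1#≢0#))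

  𝒮-[-1] : ∀ {y} → N y ≡ - 1# → 𝒮 (- 1#) (pt y)
  𝒮-[-1] {y} Ny≡-1 =
    let (x , x≢0 , frx≡xw) = hilbert90 Nw≡1
    in x , x≢0 , proportional⇒∼ (proper₂ 1#≢0#) (proper₂ (pow-nonzero q x≢0)) (begin
      y * fr x                       ≡⟨ cong (y *_) frx≡xw ⟩
      y * (x * (- 1# * inv y y≢0))   ≡⟨ solve 3 (λ y x i → y :* (x :* (:- :1 :* i)) := (y :* i) :* (x :* :- :1)) refl y x _ ⟩
      (y * inv y y≢0) * (x * - 1#)   ≡⟨ cong (_* (x * - 1#)) (*-inverseʳ y≢0) ⟩
      1# * (x * - 1#)                ∎)
    where
    open ≡-Reasoning
    y≢0 = N≡-1⇒x≢0 Ny≡-1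
    N[y⁻¹]≡-1 : N (inv y y≢0) ≡ - 1#
    N[y⁻¹]≡-1 = begin
      N (inv y y≢0)                     ≡⟨ solve 1 (λ a → a := :- (a :* :- :1)) refl _ ⟩
      - (N (inv y y≢0) * - 1#)          ≡⟨ cong (λ z → - (N (inv y y≢0) * z)) (sym Ny≡-1) ⟩
      - (N (inv y y≢0) * N y)           ≡⟨ cong -_ (N-inv y≢0) ⟩
      - 1#                              ∎
    Nw≡1 : N (- 1# * inv y y≢0) ≡ 1#
    Nw≡1 = trans (N-* (- 1#) _) (trans (cong₂ _*_ N-[-1] N[y⁻¹]≡-1) -1*-1≡1)

  RHS2-resp-∼ : ∀ {Q Q′} → Q ∼ Q′ → RHS2 Q → RHS2 Q′
  RHS2-resp-∼ Q∼Q′ = Sum.map (∼-trans (∼-sym Q∼Q′)) (Sum.map (∼-trans (∼-sym Q∼Q′))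
    (Sum.map (λ (x , x≢0 , Q∼) → x , x≢0 , ∼-trans (∼-sym Q∼Q′) Q∼)
                  (λ (θ , θ≢0 , square , x , x≢0 , Q∼) → θ , θ≢0 , square , x , x≢0 , ∼-trans (∼-sym Q∼Q′) Q∼)))

  RHS2-on-m_T : ∀ {Q} → RHS2 Q → Inc Q m_T
  RHS2-on-m_T (inj₁ Q∼φT) =
    Inc-resp-∼ m_T (∼-sym Q∼φT) (subst (λ P → Inc P m_T) (sym φT≡e1) (Inc-m_T 1# 0#))
  RHS2-on-m_T (inj₂ (inj₁ Q∼φ²T)) =
    Inc-resp-∼ m_T (∼-sym Q∼φ²T) (subst (λ P → Inc P m_T) (sym φ²T≡pt0) (Inc-m_T 0# 1#))
  RHS2-on-m_T (inj₂ (inj₂ (inj₁ (x , _ , Q∼)))) =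
    Inc-resp-∼ m_T (∼-sym Q∼) (Inc-m_T (x * - 1#) (fr x))
  RHS2-on-m_T (inj₂ (inj₂ (inj₂ (θ , _ , _ , x , _ , Q∼)))) =
    Inc-resp-∼ m_T (∼-sym Q∼) (Inc-m_T (x * θ) (fr x))

  RHS2-e1 : RHS2 e1
  RHS2-e1 = inj₁ (subst (e1 ∼_) (sym φT≡e1) (∼-refl (proper₁ 1#≢0#)))

  RHS2-pt⇒admissible : ∀ {y} → RHS2 (pt y) → Admissible y
  RHS2-pt⇒admissible (inj₁ pt∼φT)                   = ⊥-elim (e1≁pt (∼-sym (subst (_ ∼_) φT≡e1 pt∼φT)))
  RHS2-pt⇒admissible (inj₂ (inj₁ pt∼φ²T))           = inj₁ (pt-injective (subst (_ ∼_) φ²T≡pt0 pt∼φ²T))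
  RHS2-pt⇒admissible (inj₂ (inj₂ (inj₁ pt∈𝒮)))      = inj₂ (inj₁ (trans (𝒮-pt⇒N≡ pt∈𝒮) N-[-1]))
  RHS2-pt⇒admissible (inj₂ (inj₂ (inj₂ (θ , _ , (s , s∈Fq , s≢0 , s²≡Nθ) , pt∈𝒮)))) =
    inj₂ (inj₂ (s , s∈Fq , s≢0 , trans s²≡Nθ (sym (𝒮-pt⇒N≡ pt∈𝒮))))

  admissible⇒RHS2-pt : ∀ {y} → Admissible y → RHS2 (pt y)
  admissible⇒RHS2-pt (inj₁ refl)          = inj₂ (inj₁ (subst (pt 0# ∼_) (sym φ²T≡pt0) (∼-refl (proper₂ 1#≢0#))))
  admissible⇒RHS2-pt (inj₂ (inj₁ Ny≡-1))  = inj₂ (inj₂ (inj₁ (𝒮-[-1] Ny≡-1)))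
  admissible⇒RHS2-pt {y} (inj₂ (inj₂ square)) = inj₂ (inj₂ (inj₂ (y , NormIsFqSquare⇒≢0 square , square , 𝒮-self y)))

  Pr-Fig≐RHS2 : Pr Fig_T ≐ RHS2
  Pr-Fig≐RHS2 Q pQ = to , from
    where
    to : Pr Fig_T Q → RHS2 Q
    to Q∈ with Pr-Fig-classify Q∈
    ... | inj₁ Q∼e1              = RHS2-resp-∼ (∼-sym Q∼e1) RHS2-e1
    ... | inj₂ (y , Q∼pt , adm)  = RHS2-resp-∼ (∼-sym Q∼pt) (admissible⇒RHS2-pt adm)
    from : RHS2 Q → Pr Fig_T Q
    from Q∈ = Pr-Fig-on-m_T pQ (RHS2-on-m_T Q∈) (λ Q∼pt → RHS2-pt⇒admissible (RHS2-resp-∼ Q∼pt Q∈))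

  admissible-if-even : ∀ k → q ≡ 2 ℕ.* k → ∀ y → Admissible y
  admissible-if-even k q≡2k y with y ≟ 0#
  ... | yes y≡0 = inj₁ y≡0
  ... | no  y≢0 = inj₂ (inj₂ (t , t∈Fq , pow-nonzero k (N-nonzero y≢0) , t²≡Ny))
    where
    open ≡-Reasoning
    t = pow (N y) k
    t∈Fq : InFq t
    t∈Fq = trans (pow-comm (N y) k q) (cong (λ z → pow z k) (N∈Fq y))
    t²≡Ny : t * t ≡ N y
    t²≡Ny = begin
      pow (N y) k * pow (N y) k    ≡⟨ sym (pow-+ (N y) k k) ⟩
      pow (N y) (k ℕ.+ k)          ≡⟨ cong (pow (N y)) (sym (trans q≡2k (cong (k ℕ.+_) (ℕ.+-identityʳ k)))) ⟩
      fr (N y)                     ≡⟨ N∈Fq y ⟩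
      N y                          ∎

  Pr-Fig≐m_T-if-even : ∀ k → q ≡ 2 ℕ.* k → Pr Fig_T ≐ PointsOf-m_T
  Pr-Fig≐m_T-if-even k q≡2k Q pQ =
    (λ (_ , _ , _ , _ , Q∈m_T , _) → pQ , Q∈m_T) ,
    (λ (_ , Q∈m_T) → Pr-Fig-on-m_T pQ Q∈m_T (λ {t} _ → admissible-if-even k q≡2k t))

  HasSize-Pr-Fig : ∀ ys → Unique ys → (∀ {y} → y ∈ ys → Admissible y) → (∀ {y} → Admissible y → y ∈ ys) →
    HasSize (Pr Fig_T) (suc (length ys))
  HasSize-Pr-Fig ys distinct sound complete = subst (HasSize (Pr Fig_T)) (cong suc (length-map pt ys))
    (HasSize-from-list (e1 ∷ map pt ys)
      (Pr-Fig-e1 ∷ All.map⁺ (All.tabulate (Pr-Fig-pt ∘ sound)))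
      (All.map⁺ (All.tabulate (λ _ → e1≁pt)) ∷
        AllPairs.map⁺ (AllPairs.map (λ y≢y′ pt∼pt → y≢y′ (pt-injective pt∼pt)) distinct))
      covers)
    where
    covers : ∀ {Q} → Pr Fig_T Q → ∃ λ P → P ∈ e1 ∷ map pt ys × Q ∼ P
    covers Q∈ with Pr-Fig-classify Q∈
    ... | inj₁ Q∼e1              = e1 , here refl , Q∼e1
    ... | inj₂ (y , Q∼pt , adm)  = pt y , there (∈-map⁺ pt (complete adm)) , Q∼pt

  module OddOrder (r : ℕ) (q≡1+2r : q ≡ suc (2 ℕ.* r)) where

    1+2rK≡q³ : suc (2 ℕ.* (r ℕ.* K)) ≡ q ℕ.^ 3
    1+2rK≡q³ = subst (λ m → suc (2 ℕ.* (r ℕ.* (m ℕ.^ 2 ℕ.+ m ℕ.+ 1))) ≡ m ℕ.^ 3) (sym q≡1+2r) (odd-cube-identity r)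

    module Squares = PowerMap 2 (r ℕ.* K) 1+2rK≡q³

    -1≢1 : - 1# ≢ 1#
    -1≢1 -1≡1 = 1+1≢0-if-odd {r ℕ.* K} (sym 1+2rK≡q³) (trans (cong (1# +_) (sym -1≡1)) (-‿inverseʳ 1#))

    ^rK≡N^r : ∀ y → y ^ (r ℕ.* K) ≡ pow (N y) r
    ^rK≡N^r y = trans (sym (pow≡^ y (r ℕ.* K))) (trans (cong (pow y) (ℕ.*-comm r K)) (sym (pow-pow y K r)))

    NormIsFqSquare⇒y^rK≡1 : ∀ {y} → NormIsFqSquare y → y ^ (r ℕ.* K) ≡ 1#
    NormIsFqSquare⇒y^rK≡1 {y} (s , s∈Fq , s≢0 , s²≡Ny) = begin
      y ^ (r ℕ.* K)          ≡⟨ ^rK≡N^r y ⟩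
      pow (N y) r            ≡⟨ cong (λ z → pow z r) (sym s²≡Ny) ⟩
      pow (s * s) r          ≡⟨ pow-distrib-* r s s ⟩
      pow s r * pow s r      ≡⟨ sym (pow-+ s r r) ⟩
      pow s (r ℕ.+ r)        ≡⟨ s^[q-1]≡1 ⟩
      1#                     ∎
      where
      open ≡-Reasoning
      s^[q-1]≡1 : pow s (r ℕ.+ r) ≡ 1#
      s^[q-1]≡1 = *-cancelˡ s≢0 (begin
        s * pow s (r ℕ.+ r)    ≡⟨ cong (λ k → pow s (suc k)) (sym (cong (r ℕ.+_) (ℕ.+-identityʳ r))) ⟩
        pow s (suc (2 ℕ.* r))  ≡⟨ cong (pow s) (sym q≡1+2r) ⟩
        fr s                   ≡⟨ s∈Fq ⟩
        s                      ≡⟨ sym (*-identityʳ s) ⟩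
        s * 1#                 ∎)

    y^rK≡1⇒NormIsFqSquare : ∀ {y} → y ^ (r ℕ.* K) ≡ 1# → NormIsFqSquare y
    y^rK≡1⇒NormIsFqSquare {y} y^rK≡1 =
      let (z , z≢0 , z²≡y) = Squares.^-onto-rootsOfUnity y^rK≡1
      in N z , N∈Fq z , N-nonzero z≢0 , trans (sym (N-* z z)) (cong N (trans (cong (z *_) (sym (*-identityʳ z))) z²≡y))

    N≡-1⇔[-y]^K≡1 : ∀ {y} → N y ≡ - 1# ⇔ (- y) ^ K ≡ 1#
    N≡-1⇔[-y]^K≡1 {y} = mk⇔
      (λ Ny≡-1 → trans (sym (pow≡^ (- y) K)) (trans (N-neg y) (trans (cong -_ Ny≡-1) (-‿involutive 1#))))
      (λ [-y]^K≡1 → begin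
        N y           ≡⟨ cong N (sym (-‿involutive y)) ⟩
        N (- (- y))   ≡⟨ N-neg (- y) ⟩
        - N (- y)     ≡⟨ cong -_ (trans (pow≡^ (- y) K) [-y]^K≡1) ⟩
        - 1#          ∎)
      where open ≡-Reasoning

    N≡-1⇒y^rK≡[-1]^r : ∀ {y} → N y ≡ - 1# → y ^ (r ℕ.* K) ≡ (- 1#) ^ r
    N≡-1⇒y^rK≡[-1]^r {y} Ny≡-1 = trans (^rK≡N^r y) (trans (cong (λ z → pow z r) Ny≡-1) (pow≡^ (- 1#) r))

    private
      instance
        r≢0 : NonZero r
        r≢0 = ℕ.≢-nonZero λ r≡0 → ℕ.<-irrefl (sym (trans q≡1+2r (cong (λ k → suc (2 ℕ.* k)) r≡0))) 1<q
        K≢0 : NonZero K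
        K≢0 = ℕ.≢-nonZero λ K≡0 → ℕ.1+n≢0 (trans (ℕ.+-comm 1 (q ℕ.^ 2 ℕ.+ q)) K≡0)
        rK≢0 : NonZero (r ℕ.* K)
        rK≢0 = ℕ.m*n≢0 r K

      R = rootsOfUnity (r ℕ.* K)

      0∉R : ∀ {w} → w ∈ R → 0# ≢ w
      0∉R w∈R refl = 0^k≢1 (r ℕ.* K) (∈-rootsOfUnity⁻ (r ℕ.* K) w∈R)

      square-if-∈R : ∀ {y} → y ∈ R → Admissible y
      square-if-∈R y∈R = inj₂ (inj₂ (y^rK≡1⇒NormIsFqSquare (∈-rootsOfUnity⁻ (r ℕ.* K) y∈R)))

      R₁ = rootsOfUnity K
      −R₁ = map -_ R₁

      −R₁-unique : Unique −R₁
      −R₁-unique = Unique.map⁺ neg-injective (rootsOfUnity-unique K)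
        where
        neg-injective : ∀ {a b} → - a ≡ - b → a ≡ b
        neg-injective {a} {b} -a≡-b = trans (sym (-‿involutive a)) (trans (cong -_ -a≡-b) (-‿involutive b))

      N≡-1-if-∈−R₁ : ∀ {y} → y ∈ −R₁ → N y ≡ - 1#
      N≡-1-if-∈−R₁ y∈ with ∈-map⁻ -_ y∈
      ... | w , w∈R₁ , refl =
        Equivalence.from N≡-1⇔[-y]^K≡1 (trans (cong (_^ K) (-‿involutive w)) (∈-rootsOfUnity⁻ K w∈R₁))

      ∈−R₁-if-N≡-1 : ∀ {y} → N y ≡ - 1# → y ∈ −R₁
      ∈−R₁-if-N≡-1 {y} Ny≡-1 =
        subst (_∈ −R₁) (-‿involutive y) (∈-map⁺ -_ (∈-rootsOfUnity K (Equivalence.to N≡-1⇔[-y]^K≡1 Ny≡-1)))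

    size-if-r-even : ∀ j → r ≡ 2 ℕ.* j → HasSize (Pr Fig_T) (2 ℕ.+ r ℕ.* K)
    size-if-r-even j r≡2j = subst (HasSize (Pr Fig_T)) (cong (2 ℕ.+_) Squares.length-rootsOfUnity)
      (HasSize-Pr-Fig (0# ∷ R) (All.tabulate 0∉R ∷ rootsOfUnity-unique (r ℕ.* K)) sound complete)
      where
      sound : ∀ {y} → y ∈ 0# ∷ R → Admissible y
      sound (here refl) = inj₁ refl
      sound (there y∈R) = square-if-∈R y∈R
      complete : ∀ {y} → Admissible y → y ∈ 0# ∷ R
      complete (inj₁ refl)          = here refl
      complete (inj₂ (inj₁ Ny≡-1))  = there (∈-rootsOfUnity (r ℕ.* K) (trans (N≡-1⇒y^rK≡[-1]^r Ny≡-1)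
                                                                   (trans (cong (- 1# ^_) r≡2j) (-1^2k≡1 j))))
      complete (inj₂ (inj₂ square)) = there (∈-rootsOfUnity (r ℕ.* K) (NormIsFqSquare⇒y^rK≡1 square))

    size-if-r-odd : ∀ j → r ≡ suc (2 ℕ.* j) → HasSize (Pr Fig_T) (2 ℕ.+ (r ℕ.* K ℕ.+ K))
    size-if-r-odd j r≡1+2j = subst (HasSize (Pr Fig_T)) |ys|≡
      (HasSize-Pr-Fig (0# ∷ R ++ −R₁)
        (All.tabulate 0∉R++−R₁ ∷ Unique.++⁺ (rootsOfUnity-unique (r ℕ.* K)) −R₁-unique disjoint)
        sound complete)
      where
      0∉R++−R₁ : ∀ {w} → w ∈ R ++ −R₁ → 0# ≢ w
      0∉R++−R₁ w∈ = [ 0∉R , (λ w∈−R₁ → N≡-1⇒x≢0 (N≡-1-if-∈−R₁ w∈−R₁) ∘ sym) ]′ (∈-++⁻ R w∈)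
      disjoint : ∀ {v} → ¬ (v ∈ R × v ∈ −R₁)
      disjoint (v∈R , v∈−R₁) = -1≢1 (begin
        - 1#                  ≡⟨ sym (-1^[1+2k]≡-1 j) ⟩
        (- 1#) ^ suc (2 ℕ.* j) ≡⟨ cong (- 1# ^_) (sym r≡1+2j) ⟩
        (- 1#) ^ r            ≡⟨ sym (N≡-1⇒y^rK≡[-1]^r (N≡-1-if-∈−R₁ v∈−R₁)) ⟩
        _ ^ (r ℕ.* K)         ≡⟨ ∈-rootsOfUnity⁻ (r ℕ.* K) v∈R ⟩
        1#                    ∎)
        where open ≡-Reasoning
      sound : ∀ {y} → y ∈ 0# ∷ R ++ −R₁ → Admissible y
      sound (here refl) = inj₁ refl
      sound (there y∈)  = [ square-if-∈R , inj₂ ∘ inj₁ ∘ N≡-1-if-∈−R₁ ]′ (∈-++⁻ R y∈)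
      complete : ∀ {y} → Admissible y → y ∈ 0# ∷ R ++ −R₁
      complete (inj₁ refl)             = here refl
      complete (inj₂ (inj₁ Ny≡-1))     = there (∈-++⁺ʳ R (∈−R₁-if-N≡-1 Ny≡-1))
      complete (inj₂ (inj₂ square))    = there (∈-++⁺ˡ (∈-rootsOfUnity (r ℕ.* K) (NormIsFqSquare⇒y^rK≡1 square)))
      |ys|≡ : suc (length (0# ∷ R ++ −R₁)) ≡ 2 ℕ.+ (r ℕ.* K ℕ.+ K)
      |ys|≡ = cong (2 ℕ.+_) (trans (length-++ R) (cong₂ ℕ._+_ Squares.length-rootsOfUnity
                                                  (trans (length-map -_ R₁) NormOne.length-rootsOfUnity)))

    size-if-1-mod-4 : q ℕ.% 4 ≡ 1 → HasSize (Pr Fig_T) (2 ℕ.+ ((q ℕ.∸ 1) ℕ./ 2) ℕ.* K)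
    size-if-1-mod-4 q%4≡1 = subst (λ h → HasSize (Pr Fig_T) (2 ℕ.+ h ℕ.* K)) (sym ([n∸1]/2≡r q r q≡1+2r))
      (size-if-r-even (q ℕ./ 4) (n%4≡1⇒r≡2*[n/4] q r q≡1+2r q%4≡1))

    size-if-3-mod-4 : q ℕ.% 4 ≡ 3 → HasSize (Pr Fig_T) (2 ℕ.+ ((q ℕ.+ 1) ℕ./ 2) ℕ.* K)
    size-if-3-mod-4 q%4≡3 = subst (λ h → HasSize (Pr Fig_T) (2 ℕ.+ h)) rK+K≡[q+1]/2*K
      (size-if-r-odd (q ℕ./ 4) (n%4≡3⇒r≡1+2*[n/4] q r q≡1+2r q%4≡3))
      where
      rK+K≡[q+1]/2*K : r ℕ.* K ℕ.+ K ≡ (q ℕ.+ 1) ℕ./ 2 ℕ.* K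
      rK+K≡[q+1]/2*K = trans (ℕ.+-comm (r ℕ.* K) K) (cong (ℕ._* K) (sym ([n+1]/2≡1+r q r q≡1+2r)))

open import Data.Nat using (ℕ; _^_; _+_; _*_; _∸_; _/_; _%_)

theorem6p1 : (q : ℕ) → IsPrimePower q → (F : FiniteField (q ^ 3)) →
    let open Plane q F in
      (q % 2 ≡ 0 → Pr Fig_T ≐ PointsOf-m_T)
    × (q % 2 ≡ 1 →
        (Pr Fig_T ≐ RHS2)
      × (q % 4 ≡ 1 → HasSize (Pr Fig_T) (2 + ((q ∸ 1) / 2) * (q ^ 2 + q + 1)))
      × (q % 4 ≡ 3 → HasSize (Pr Fig_T) (2 + ((q + 1) / 2) * (q ^ 2 + q + 1))))
theorem6p1 q _ F = Pr-Fig≐m_T-if-even (q / 2) ∘ n%2≡0⇒n≡2*[n/2] q , λ q%2≡1 →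
  let open OddOrder (q / 2) (n%2≡1⇒n≡1+2*[n/2] q q%2≡1) in Pr-Fig≐RHS2 , size-if-1-mod-4 , size-if-3-mod-4
  where open FigBlock q F
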